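{- Let $k$ be a field, $h\ge 1$, and $d_1 \geq d_2 \geq d_3$ integers between $0$ and $h$, $\mu = (d_1,d_2,d_3)$. Let $M$ be a finite-dimensional $k[T]/T^3$-module generated by at most $h$ elements, with a PR datum $0 \subseteq M_1 \subseteq M_2 \subseteq M_3 = M$ of type $\mu$. Then $(\mathrm{Hdg}(M), \mathrm{Hdg}(M_2), \mathrm{Hdg}(M/M_1)) \in Y$, where $M$ is viewed as a $k[T]/T^3$-module and $M_2$, $M/M_1$ as $k[T]/T^2$-modules. In particular this assignment gives a well-defined map $\phi$ from the set of isomorphism classes of $k[T]/T^3$-modules with a PR datum of type $\mu$ to $Y$.
   Context: A PR datum of type $(d_1,d_2,d_3)$ for $M$ is a filtration $0 = M_0 \subseteq M_1 \subseteq M_2 \subseteq M_3 = M$ of $k$-subspaces with $T M_i \subseteq M_{i-1}$ and $\dim M_i/M_{i-1} = d_i$. For a $k[T]/T^j$-module $M'$ generated by at most $h$ elements, $M' \simeq \bigoplus_{l=1}^h k[T]/T^{a_l}$, $\mathrm{Hdg}(M')$ is the convex polygon on $[0,h]$ starting at $0$ with slopes $a_l/j$. For integers $c_1,\dots,c_N\in[0,h]$, $P(c_1, \dots, c_N)(x) = \frac{1}{N}\sum_{i=1}^N \max(0, x + c_i - h)$ on $[0,h]$; $\mathcal{P}_N$ is the set of polygons of this form (equivalently convex polygons on $[0,h]$ starting at $0$ with integral breakpoint abscissae and slopes in $\frac1N\mathbb{Z}\cap[0,1]$). For $P_1\in\mathcal{P}_{N_1}$, $P_2\in\mathcal{P}_{N_2}$,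 $P_1 \star P_2 = \frac{1}{N_1+N_2}(N_1P_1+N_2P_2)\in\mathcal{P}_{N_1+N_2}$. $P \geq Q$ means $P(x)\ge Q(x)$ on $[0,h]$. $Y$ is the set of triples $(P_1,P_2,P_3)$ with $P_1 \in \mathcal{P}_3$, $P_2, P_3 \in \mathcal{P}_2$, $P_1(h) = (d_1+d_2+d_3)/3$, $P_2(h) = (d_1+d_2)/2$, $P_3(h) = (d_2+d_3)/2$, $P_1 \geq P_2 \star P(d_3)$, $P_1 \geq P_3 \star P(d_1)$, $P_2 \geq P(d_1,d_2)$ and $P_3 \geq P(d_2,d_3)$.
   Formalization: The polygon comparisons $P \geq Q$ and membership in $\mathcal{P}_N$ are checked only at rational points of [0,h], rather than at all real x. -}

module Defs where

open import Level using (Level; _⊔_)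
open import Algebra.Bundles using (CommutativeRing)
open import Data.Nat as ℕ using (ℕ; zero; suc; _+_; _<ᵇ_; NonZero)
open import Data.Nat.Properties using (≤-decTotalOrder; +-assoc)
open import Data.Fin using (Fin; toℕ; _↑ˡ_; _↑ʳ_; cast)
open import Data.Bool using (if_then_else_)
open import Data.List using (List; []; _∷_; length; tabulate; map)
open import Data.Product using (Σ; ∃; _×_; _,_)
open import Data.Integer using (+_)
open import Data.Rational as Q using (ℚ; 0ℚ; _/_) renaming (_≤_ to _≤ℚ_)
open import Relation.Nullary using (¬_)
open import Relation.Binary.PropositionalEquality using (_≡_; sym)
import Data.List.Sort.InsertionSort as InsSort

record Field (c ℓ : Level) : Set (Level.suc (c ⊔ ℓ)) where
  field
    commutativeRing : CommutativeRing c ℓ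
  open CommutativeRing commutativeRing public
  field
    0≉1     : ¬ (0# ≈ 1#)
    inverse : ∀ x → ¬ (x ≈ 0#) → Σ Carrier λ y → (x * y) ≈ 1#

module LinAlg {c ℓ : Level} (F : Field c ℓ) where
  open Field F using (Carrier; _≈_; 0#) renaming (_+_ to _⊕_; _*_ to _⊗_)

  Vect : ℕ → Set c
  Vect n = Fin n → Carrier

  Mat : ℕ → ℕ → Set c
  Mat m n = Fin m → Fin n → Carrier

  ∑ : (n : ℕ) → (Fin n → Carrier) → Carrier
  ∑ zero    f = 0#
  ∑ (suc n) f = f Fin.zero ⊕ ∑ n (λ i → f (Fin.suc i))
    where import Data.Fin as Fin

  _≈ᵥ_ : ∀ {n} → Vect n → Vect n → Set ℓ
  u ≈ᵥ v = ∀ i → u i ≈ v i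

  0ᵥ : ∀ {n} → Vect n
  0ᵥ _ = 0#

  _·_ : ∀ {n} → Carrier → Vect n → Vect n
  (a · v) i = a ⊗ v i

  ∑ᵥ : ∀ {n} (m : ℕ) → (Fin m → Vect n) → Vect n
  ∑ᵥ m vs i = ∑ m (λ j → vs j i)

  _⊛_ : ∀ {m n} → Mat m n → Vect n → Vect m
  (A ⊛ v) i = ∑ _ (λ j → A i j ⊗ v j)

  pow : ∀ {n} → Mat n n → ℕ → Vect n → Vect n
  pow A zero    v = v
  pow A (suc e) v = A ⊛ pow A e v

  -- The k[T]/T^j-module (k^n, T acting by A):  A^j = 0.
  IsModuleOver : ∀ {n} → ℕ → Mat n n → Set (c ⊔ ℓ)
  IsModuleOver j A = ∀ v → pow A j v ≈ᵥ 0ᵥ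

  GeneratedBy≤ : ∀ {n} → ℕ → ℕ → Mat n n → Set (c ⊔ ℓ)
  GeneratedBy≤ j h A =
    Σ (Fin h → Vect _) λ g → ∀ v →
      Σ (Fin h → Fin j → Carrier) λ co →
        v ≈ᵥ ∑ᵥ h (λ l → ∑ᵥ j (λ e → co l e · pow A (toℕ e) (g l)))

  -- (k^n, A) ≅ ⊕_{l=1}^h k[T]/T^{a_l}: there are g₁,…,g_h with A^{a_l} g_l = 0
  -- such that {A^e g_l | l, e < a_l} is a k-basis (the k[T]-linear map
  -- ⊕ k[T]/T^{a_l} → k^n sending the generator of the l-th summand to g_l
  -- is then an isomorphism).
  IsCyclicDecomp : ∀ {n} (h : ℕ) → Mat n n → (Fin h → ℕ) → Set (c ⊔ ℓ)
  IsCyclicDecomp h A a =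
    Σ (Fin h → Vect _) λ g →
        (∀ l → pow A (a l) (g l) ≈ᵥ 0ᵥ)
      × (∀ v → Σ ((l : Fin h) → Fin (a l) → Carrier) λ co →
            v ≈ᵥ ∑ᵥ h (λ l → ∑ᵥ (a l) (λ e → co l e · pow A (toℕ e) (g l))))
      × (∀ (co : (l : Fin h) → Fin (a l) → Carrier) →
            ∑ᵥ h (λ l → ∑ᵥ (a l) (λ e → co l e · pow A (toℕ e) (g l))) ≈ᵥ 0ᵥ →
            ∀ l e → co l e ≈ 0#)

-- PR data in adapted coordinates.
-- M = k^{d₁+d₂+d₃}; the filtration is the standard flag
-- M_i = span of the first d₁+…+d_i coordinate vectors.
-- layer of a coordinate index: 1, 2 or 3.

layer : (d₁ d₂ : ℕ) → ℕ → ℕ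
layer d₁ d₂ r = if r <ᵇ d₁ then 1 else (if r <ᵇ d₁ + d₂ then 2 else 3)

module PR {c ℓ : Level} (F : Field c ℓ) where
  open Field F using (_≈_; 0#)
  open LinAlg F

  -- T M_i ⊆ M_{i-1} for the standard flag: the column of basis vector e_col
  -- has no components in layers ≥ layer(col).
  IsPRDatum : (d₁ d₂ d₃ : ℕ) → Mat (d₁ + d₂ + d₃) (d₁ + d₂ + d₃) → Set ℓ
  IsPRDatum d₁ d₂ d₃ A = ∀ row col →
    layer d₁ d₂ (toℕ col) ℕ.≤ layer d₁ d₂ (toℕ row) → A row col ≈ 0#

  onM₂ : (d₁ d₂ d₃ : ℕ) → Mat (d₁ + d₂ + d₃) (d₁ + d₂ + d₃) → Mat (d₁ + d₂) (d₁ + d₂)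
  onM₂ d₁ d₂ d₃ A r s = A (r ↑ˡ d₃) (s ↑ˡ d₃)

  -- T acting on M/M₁, with basis the images of e_{d₁+1} … e_{d₁+d₂+d₃}
  -- (bottom-right block)
  quotIdx : (d₁ d₂ d₃ : ℕ) → Fin (d₂ + d₃) → Fin (d₁ + d₂ + d₃)
  quotIdx d₁ d₂ d₃ i = cast (sym (+-assoc d₁ d₂ d₃)) (d₁ ↑ʳ i)

  onM/M₁ : (d₁ d₂ d₃ : ℕ) → Mat (d₁ + d₂ + d₃) (d₁ + d₂ + d₃) → Mat (d₂ + d₃) (d₂ + d₃)
  onM/M₁ d₁ d₂ d₃ A r s = A (quotIdx d₁ d₂ d₃ r) (quotIdx d₁ d₂ d₃ s)

-- Polygons, as functions ℚ → ℚ (only their values on [0,h] matter).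

Polygon : Set
Polygon = ℚ → ℚ

ℕ→ℚ : ℕ → ℚ
ℕ→ℚ n = + n / 1

clamp01 : ℚ → ℚ
clamp01 x = 0ℚ Q.⊔ (x Q.⊓ Q.1ℚ)

fromSlopes : List ℚ → Polygon
fromSlopes []       x = 0ℚ
fromSlopes (s ∷ ss) x = s Q.* clamp01 x Q.+ fromSlopes ss (x Q.- Q.1ℚ)

open InsSort ≤-decTotalOrder using (sort)

-- Hdg of ⊕_{l=1}^h k[T]/T^{a_l} viewed as k[T]/T^j-module: the convex
-- polygon on [0,h] starting at 0 with slopes a_l/j (sorted increasingly).
Hdg : (j : ℕ) → .{{NonZero j}} → (h : ℕ) → (Fin h → ℕ) → Polygon
Hdg j h a = fromSlopes (map (λ n → + n / j) (sort (tabulate a)))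

P : (h : ℕ) → List ℕ → Polygon
P h []       x = 0ℚ
P h (c ∷ cs) x =
  (+ 1 / suc (length cs)) Q.* sumTerms (c ∷ cs)
  where
  sumTerms : List ℕ → ℚ
  sumTerms []       = 0ℚ
  sumTerms (d ∷ ds) = (0ℚ Q.⊔ (x Q.+ ℕ→ℚ d Q.- ℕ→ℚ h)) Q.+ sumTerms ds

InRange : ℕ → ℚ → Set
InRange h x = (0ℚ ≤ℚ x) × (x ≤ℚ ℕ→ℚ h)

_≥[_]_ : Polygon → ℕ → Polygon → Set
P₁ ≥[ h ] P₂ = ∀ x → InRange h x → P₂ x ≤ℚ P₁ x

In𝒫 : (N h : ℕ) → Polygon → Set
In𝒫 N h Pol = Σ (Fin N → ℕ) λ cs →
  (∀ i → cs i ℕ.≤ h) × (∀ x → InRange h x → Pol x ≡ P h (tabulate cs) x)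

star : (N₁ N₂ : ℕ) → .{{NonZero (N₁ + N₂)}} → Polygon → Polygon → Polygon
star N₁ N₂ P₁ P₂ x =
  (ℕ→ℚ N₁ Q.* P₁ x Q.+ ℕ→ℚ N₂ Q.* P₂ x) Q.* (+ 1 / (N₁ + N₂))

InY : (h d₁ d₂ d₃ : ℕ) → Polygon → Polygon → Polygon → Set
InY h d₁ d₂ d₃ P₁ P₂ P₃ =
    In𝒫 3 h P₁ × In𝒫 2 h P₂ × In𝒫 2 h P₃
  × P₁ (ℕ→ℚ h) ≡ + (d₁ + d₂ + d₃) / 3
  × P₂ (ℕ→ℚ h) ≡ + (d₁ + d₂) / 2
  × P₃ (ℕ→ℚ h) ≡ + (d₂ + d₃) / 2
  × P₁ ≥[ h ] star 2 1 P₂ (P h (d₃ ∷ []))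
  × P₁ ≥[ h ] star 2 1 P₃ (P h (d₁ ∷ []))
  × P₂ ≥[ h ] P h (d₁ ∷ d₂ ∷ [])
  × P₃ ≥[ h ] P h (d₂ ∷ d₃ ∷ [])

module Submission where

open import Defs
open import Level using (Level)
open import Function using (_∘_)
open import Function.Bundles using (Equivalence)
open import Data.Nat using (ℕ; zero; suc; _∸_; _<ᵇ_; _≤_; _≥_)
import Data.Nat as ℕ
import Data.Nat.Properties as ℕ
open import Data.Bool using (true; false)
open import Data.Bool.Properties using (T-≡; ¬-not)
open import Data.Fin as Fin using (Fin; zero; suc; toℕ; _↑ˡ_; _↑ʳ_; cast; splitAt; punchIn; inject₁; fromℕ)
import Data.Fin.Properties as Fin
open import Data.Fin.Patterns using (0F; 1F; 2F)
open import Data.Product using (Σ; _×_; _,_; proj₁; proj₂)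
open import Data.Sum using (inj₁; inj₂; [_,_]′)
open import Data.Vec.Functional using (_++_)
open import Data.Vec.Functional.Properties using (lookup-++ˡ; lookup-++ʳ)
import Relation.Binary.PropositionalEquality as ≡
open ≡ using (_≡_)
open import Algebra.Properties.CommutativeMonoid.Sum ℕ.+-0-commutativeMonoid as ℕ-Sum
  using () renaming (sum to sumℕ)

-- For M ≅ ⊕_l k[T]/T^{a_l} one has dim M = Σ a_l and rank T^k = Σ_l (a_l ∸ k): the vectors
-- T^e g_l form a basis, and Steinitz exchange compares the shifted families T^{e+k} g_l with
-- any spanning set of the image of T^k. The PR condition T M_i ⊆ M_{i-1} makes the matrix of T
-- block triangular, so im T ⊆ im(T|M₂) + span(third layer), im T² ⊆ im(T|M₂), and similarly
-- im T ⊆ σ(im T̄) + M₁, im T² ⊆ T σ(im T̄) for a section σ of M → M/M₁; moreover im(T|M₂) ⊆ M₁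
-- and im T̄ ⊆ M₂/M₁. These give
--   rank T ≤ rank T|M₂ + d₃,  rank T² ≤ rank T|M₂,  rank T|M₂ ≤ d₂,
--   rank T ≤ rank T̄ + d₁,     rank T² ≤ rank T̄,     rank T̄ ≤ d₃.
-- On the polygon side, Hdg of ⊕ k[T]/T^{a_l} as a k[T]/T^j-module is P(α₁,…,α_j) with
-- α_i = #{l | a_l ≥ i}, since a slope a/j splits into j slopes 1/j·[a ≥ i]; and
-- α_{k+1} + … + α_j = Σ_l (a_l ∸ k). So the rank inequalities become linear inequalities
-- between the level counts α, β, ε of M, M₂, M/M₁, which amount to weak majorizations.
-- Finally Σ_i max(0, x + g_i − h) is the largest subset sum of the x + g_i − h, so weak
-- majorization of g by c gives P(g) ≤ P(c).

module LinearAlgebra {c ℓ : Level} (F : Field c ℓ) where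
  open import Level using (_⊔_)
  open import Data.Empty using (⊥-elim)
  open import Relation.Nullary using (¬_; yes; no)
  open Field F hiding (zero)
  open LinAlg F
  open import Algebra.Properties.Semiring.Sum semiring as Sum using (sum)
  open import Algebra.Properties.Ring ring using (-‿distribˡ-*)
  open import Algebra.Solver.Ring.NaturalCoefficients.Default commutativeSemiring
    using (solve; _:+_; _:*_; _:=_)
  open import Relation.Binary.Reasoning.Setoid setoid

  ∑≡sum : ∀ n (f : Fin n → Carrier) → ∑ n f ≡ sum f
  ∑≡sum zero    f = ≡.refl
  ∑≡sum (suc n) f = ≡.cong (f zero +_) (∑≡sum n (f ∘ suc))

  ∑-cong : ∀ n {f g : Fin n → Carrier} → (∀ i → f i ≈ g i) → ∑ n f ≈ ∑ n g
  ∑-cong zero    f≈g = refl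
  ∑-cong (suc n) f≈g = +-cong (f≈g zero) (∑-cong n (f≈g ∘ suc))

  ∑-zero : ∀ n {f : Fin n → Carrier} → (∀ i → f i ≈ 0#) → ∑ n f ≈ 0#
  ∑-zero zero    f≈0 = refl
  ∑-zero (suc n) f≈0 = trans (+-cong (f≈0 zero) (∑-zero n (f≈0 ∘ suc))) (+-identityˡ 0#)

  ∑-distrib-+ : ∀ n (f g : Fin n → Carrier) → ∑ n (λ i → f i + g i) ≈ ∑ n f + ∑ n g
  ∑-distrib-+ n f g
    rewrite ∑≡sum n (λ i → f i + g i) | ∑≡sum n f | ∑≡sum n g = Sum.∑-distrib-+ f g

  ∑-comm : ∀ m n (f : Fin m → Fin n → Carrier) →
           ∑ m (λ i → ∑ n (f i)) ≈ ∑ n (λ j → ∑ m (λ i → f i j))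
  ∑-comm zero    n f = sym (∑-zero n (λ _ → refl))
  ∑-comm (suc m) n f = trans (+-cong refl (∑-comm m n (f ∘ suc))) (sym (∑-distrib-+ n _ _))

  *-distribˡ-∑ : ∀ n a (f : Fin n → Carrier) → a * ∑ n f ≈ ∑ n (λ i → a * f i)
  *-distribˡ-∑ n a f
    rewrite ∑≡sum n f | ∑≡sum n (λ i → a * f i) = Sum.*-distribˡ-sum a f

  *-distribʳ-∑ : ∀ n a (f : Fin n → Carrier) → ∑ n f * a ≈ ∑ n (λ i → f i * a)
  *-distribʳ-∑ n a f
    rewrite ∑≡sum n f | ∑≡sum n (λ i → f i * a) = Sum.*-distribʳ-sum a f

  ∑-punchIn : ∀ n (k : Fin (suc n)) (f : Fin (suc n) → Carrier) →
              ∑ (suc n) f ≈ f k + ∑ n (f ∘ punchIn k)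
  ∑-punchIn n k f
    rewrite ∑≡sum (suc n) f | ∑≡sum n (f ∘ punchIn k) = Sum.sum-remove f

  ∑-init-last : ∀ n (f : Fin (suc n) → Carrier) → ∑ (suc n) f ≈ ∑ n (f ∘ inject₁) + f (fromℕ n)
  ∑-init-last n f
    rewrite ∑≡sum (suc n) f | ∑≡sum n (f ∘ inject₁) = Sum.sum-init-last f

  ∑-++ : ∀ m n (f : Fin (m ℕ.+ n) → Carrier) →
         ∑ (m ℕ.+ n) f ≈ ∑ m (λ i → f (i ↑ˡ n)) + ∑ n (λ j → f (m ↑ʳ j))
  ∑-++ zero    n f = sym (+-identityˡ _)
  ∑-++ (suc m) n f = trans (+-cong refl (∑-++ m n (f ∘ suc))) (sym (+-assoc _ _ _))

  δ : ∀ {n} → Fin n → Fin n → Carrier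
  δ i j with i Fin.≟ j
  ... | yes _ = 1#
  ... | no  _ = 0#

  δ-refl : ∀ {n} (i : Fin n) → δ i i ≈ 1#
  δ-refl i with i Fin.≟ i
  ... | yes _ = refl
  ... | no i≢i = ⊥-elim (i≢i ≡.refl)

  δ-≢ : ∀ {n} {i j : Fin n} → ¬ i ≡ j → δ i j ≈ 0#
  δ-≢ {i = i} {j} i≢j with i Fin.≟ j
  ... | yes i≡j = ⊥-elim (i≢j i≡j)
  ... | no  _   = refl

  ∑-δ : ∀ n (f : Fin n → Carrier) i → ∑ n (λ j → f j * δ j i) ≈ f i
  ∑-δ (suc n) f i = begin
    ∑ (suc n) (λ j → f j * δ j i)                        ≈⟨ ∑-punchIn n i (λ j → f j * δ j i) ⟩
    f i * δ i i + ∑ n (λ j → f (punchIn i j) * δ (punchIn i j) i)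
      ≈⟨ +-cong (*-cong refl (δ-refl i)) (∑-zero n (λ j → trans (*-cong refl (δ-≢ (Fin.punchInᵢ≢i i j))) (zeroʳ _))) ⟩
    f i * 1# + 0#                                        ≈⟨ trans (+-identityʳ _) (*-identityʳ _) ⟩
    f i                                                  ∎

  standardBasis : ∀ {n} → Fin n → Vect n
  standardBasis = δ

  _+ᵥ_ : ∀ {n} → Vect n → Vect n → Vect n
  (u +ᵥ v) i = u i + v i

  lincomb : ∀ {m n} → (Fin m → Carrier) → (Fin m → Vect n) → Vect n
  lincomb {m} co w i = ∑ m (λ j → co j * w j i)

  InSpan : ∀ {p n} → (Fin p → Vect n) → Vect n → Set (c ⊔ ℓ)
  InSpan {p} w v = Σ (Fin p → Carrier) λ co → v ≈ᵥ lincomb co w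

  LinearlyIndependent : ∀ {m n} → (Fin m → Vect n) → Set (c ⊔ ℓ)
  LinearlyIndependent u = ∀ co → lincomb co u ≈ᵥ 0ᵥ → ∀ i → co i ≈ 0#

  lincomb-zero : ∀ {m n} (co : Fin m → Carrier) (w : Fin m → Vect n) →
                 (∀ j → co j ≈ 0#) → lincomb co w ≈ᵥ 0ᵥ
  lincomb-zero {m} co w co≈0 i = ∑-zero m (λ j → trans (*-cong (co≈0 j) refl) (zeroˡ _))

  InSpan-standardBasis : ∀ {n} (v : Vect n) → InSpan standardBasis v
  InSpan-standardBasis {n} v = v , λ i → sym (∑-δ n v i)

  standardBasis-independent : ∀ {n} → LinearlyIndependent (standardBasis {n})
  standardBasis-independent {n} co co·e≈0 i = trans (sym (∑-δ n co i)) (co·e≈0 i)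

  InSpan-resp-≈ᵥ : ∀ {p n} {w : Fin p → Vect n} {v v′} → InSpan w v → v′ ≈ᵥ v → InSpan w v′
  InSpan-resp-≈ᵥ (co , v≈) v′≈v = co , λ i → trans (v′≈v i) (v≈ i)

  InSpan-++ : ∀ {p q n} {w₁ : Fin p → Vect n} {w₂ : Fin q → Vect n} {v₁ v₂} →
              InSpan w₁ v₁ → InSpan w₂ v₂ → InSpan (w₁ ++ w₂) (v₁ +ᵥ v₂)
  InSpan-++ {p} {q} {n} {w₁} {w₂} (c₁ , v₁≈) (c₂ , v₂≈) = c₁ ++ c₂ , λ i → begin
    _                                  ≈⟨ +-cong (v₁≈ i) (v₂≈ i) ⟩
    lincomb c₁ w₁ i + lincomb c₂ w₂ i
      ≈⟨ sym (+-cong (∑-cong p (λ j → entry (lookup-++ˡ c₁ c₂ j) (lookup-++ˡ w₁ w₂ j)))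
                     (∑-cong q (λ j → entry (lookup-++ʳ c₁ c₂ j) (lookup-++ʳ w₁ w₂ j)))) ⟩
    _                                  ≈⟨ sym (∑-++ p q _) ⟩
    lincomb (c₁ ++ c₂) (w₁ ++ w₂) i    ∎
    where
    entry : ∀ {a a′ : Carrier} {u u′ : Vect n} {i} → a ≡ a′ → u ≡ u′ → a * u i ≈ a′ * u′ i
    entry ≡.refl ≡.refl = refl

  ¬¬-∀-Fin : ∀ p {P : Fin p → Set ℓ} → (∀ k → ¬ ¬ P k) → ¬ ¬ (∀ k → P k)
  ¬¬-∀-Fin zero    _     ¬∀ = ¬∀ (λ ())
  ¬¬-∀-Fin (suc p) ¬¬P ¬∀ =
    ¬¬P zero (λ P₀ → ¬¬-∀-Fin p (¬¬P ∘ suc) (λ Pₛ → ¬∀ λ { zero → P₀ ; (suc k) → Pₛ k }))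

  elimination-identity : ∀ a b b⁻¹ w s t → b * b⁻¹ ≈ 1# →
              (a * w + s) + (- (a * b⁻¹)) * (b * w + t) ≈ s + (- (a * b⁻¹)) * t
  elimination-identity a b b⁻¹ w s t bb⁻¹≈1 = begin
    (a * w + s) + (- (a * b⁻¹)) * (b * w + t)
      ≈⟨ solve 6 (λ a b x w s t → (a :* w :+ s) :+ x :* (b :* w :+ t) := (s :+ x :* t) :+ (a :* w :+ x :* b :* w))
               refl a b (- (a * b⁻¹)) w s t ⟩
    (s + (- (a * b⁻¹)) * t) + (a * w + (- (a * b⁻¹)) * b * w)
      ≈⟨ +-cong refl (+-cong refl cancel) ⟩
    (s + (- (a * b⁻¹)) * t) + (a * w + - (a * w))
      ≈⟨ trans (+-cong refl (-‿inverseʳ _)) (+-identityʳ _) ⟩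
    s + (- (a * b⁻¹)) * t ∎
    where
    a*b⁻¹*b≈a : a * b⁻¹ * b ≈ a
    a*b⁻¹*b≈a = trans (*-assoc a b⁻¹ b) (trans (*-cong refl (trans (*-comm b⁻¹ b) bb⁻¹≈1)) (*-identityʳ a))
    cancel : (- (a * b⁻¹)) * b * w ≈ - (a * w)
    cancel = begin
      (- (a * b⁻¹)) * b * w ≈⟨ *-cong (sym (-‿distribˡ-* (a * b⁻¹) b)) refl ⟩
      (- (a * b⁻¹ * b)) * w ≈⟨ sym (-‿distribˡ-* _ w) ⟩
      - (a * b⁻¹ * b * w)   ≈⟨ -‿cong (*-cong a*b⁻¹*b≈a refl) ⟩
      - (a * w)             ∎

  shear : ∀ {m n} → (Fin (suc m) → Vect n) → (Fin m → Carrier) → Fin m → Vect n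
  shear u t i r = u (suc i) r + t i * u zero r

  shear-independent : ∀ {m n} (u : Fin (suc m) → Vect n) (t : Fin m → Carrier) →
                      LinearlyIndependent u → LinearlyIndependent (shear u t)
  shear-independent {m} u t ind d d·u′≈0 i = ind D D·u≈0 (suc i)
    where
    D : Fin (suc m) → Carrier
    D zero    = ∑ m (λ i → d i * t i)
    D (suc i) = d i
    D·u≈0 : lincomb D u ≈ᵥ 0ᵥ
    D·u≈0 r = begin
      D zero * u zero r + ∑ m (λ i → d i * u (suc i) r)
        ≈⟨ +-comm _ _ ⟩
      ∑ m (λ i → d i * u (suc i) r) + ∑ m (λ i → d i * t i) * u zero r
        ≈⟨ +-cong refl (*-distribʳ-∑ m _ _) ⟩
      ∑ m (λ i → d i * u (suc i) r) + ∑ m (λ i → d i * t i * u zero r)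
        ≈⟨ sym (∑-distrib-+ m _ _) ⟩
      ∑ m (λ i → d i * u (suc i) r + d i * t i * u zero r)
        ≈⟨ ∑-cong m (λ i → trans (+-cong refl (*-assoc _ _ _)) (sym (distribˡ _ _ _))) ⟩
      lincomb d (shear u t) r
        ≈⟨ d·u′≈0 r ⟩
      0# ∎

  InSpan-eliminate : ∀ {n p} (w : Fin (suc p) → Vect n) (k : Fin (suc p)) {v v₀ c⁻¹}
    (v∈w : InSpan w v) (v₀∈w : InSpan w v₀) → proj₁ v₀∈w k * c⁻¹ ≈ 1# →
    InSpan (w ∘ punchIn k) (λ r → v r + (- (proj₁ v∈w k * c⁻¹)) * v₀ r)
  InSpan-eliminate {p = p} w k {v} {v₀} {c⁻¹} (cv , v≈) (c₀ , v₀≈) c₀c⁻¹≈1 =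
    (λ j → cv (punchIn k j) + t * c₀ (punchIn k j)) , λ r → begin
      v r + t * v₀ r
        ≈⟨ +-cong (v≈ r) (*-cong refl (v₀≈ r)) ⟩
      lincomb cv w r + t * lincomb c₀ w r
        ≈⟨ +-cong (∑-punchIn p k (λ j → cv j * w j r)) (*-cong refl (∑-punchIn p k (λ j → c₀ j * w j r))) ⟩
      (cv k * w k r + ∑ p (λ j → cv (punchIn k j) * w (punchIn k j) r))
        + t * (c₀ k * w k r + ∑ p (λ j → c₀ (punchIn k j) * w (punchIn k j) r))
        ≈⟨ elimination-identity (cv k) (c₀ k) c⁻¹ (w k r) _ _ c₀c⁻¹≈1 ⟩
      ∑ p (λ j → cv (punchIn k j) * w (punchIn k j) r) + t * ∑ p (λ j → c₀ (punchIn k j) * w (punchIn k j) r)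
        ≈⟨ +-cong refl (*-distribˡ-∑ p t _) ⟩
      ∑ p (λ j → cv (punchIn k j) * w (punchIn k j) r) + ∑ p (λ j → t * (c₀ (punchIn k j) * w (punchIn k j) r))
        ≈⟨ sym (∑-distrib-+ p _ _) ⟩
      ∑ p (λ j → cv (punchIn k j) * w (punchIn k j) r + t * (c₀ (punchIn k j) * w (punchIn k j) r))
        ≈⟨ ∑-cong p (λ j → trans (+-cong refl (sym (*-assoc _ _ _))) (sym (distribʳ _ _ _))) ⟩
      lincomb (λ j → cv (punchIn k j) + t * c₀ (punchIn k j)) (w ∘ punchIn k) r ∎
    where
    t : Carrier
    t = - (cv k * c⁻¹)

  -- Equality in F is not decidable, so a nonzero coefficient of u zero is only found under a double
  -- negation; this is harmless because the goal m ≤ p is decidable.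
  mutual
    steinitz : ∀ {n} m p (u : Fin m → Vect n) (w : Fin p → Vect n) →
               LinearlyIndependent u → (∀ i → InSpan w (u i)) → m ℕ.≤ p
    steinitz zero    p u w _   _     = ℕ.z≤n
    steinitz (suc m) p u w ind u∈w with suc m ℕ.≤? p
    ... | yes m<p = m<p
    ... | no  m≮p = ⊥-elim (¬¬-∀-Fin p (λ k co≉0 → m≮p (exchange m p u w ind u∈w k co≉0)) coeff≉0)
      where
      co : Fin p → Carrier
      co = proj₁ (u∈w zero)
      coeff≉0 : ¬ (∀ k → co k ≈ 0#)
      coeff≉0 co≈0 = 0≉1 (sym (ind (λ { zero → 1# ; (suc _) → 0# }) u₀≈0 zero))
        where
        u₀≈0 : lincomb (λ { zero → 1# ; (suc _) → 0# }) u ≈ᵥ 0ᵥ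
        u₀≈0 r = begin
          1# * u zero r + ∑ m (λ j → 0# * u (suc j) r) ≈⟨ +-cong (*-identityˡ _) (∑-zero m (λ j → zeroˡ _)) ⟩
          u zero r + 0#                                 ≈⟨ +-identityʳ _ ⟩
          u zero r                                      ≈⟨ proj₂ (u∈w zero) r ⟩
          lincomb co w r                                ≈⟨ lincomb-zero co w co≈0 r ⟩
          0#                                            ∎

    -- If u₀ has a nonzero k-th coordinate, w k can be replaced by u₀ and then dropped.
    exchange : ∀ {n} m p (u : Fin (suc m) → Vect n) (w : Fin p → Vect n) →
               LinearlyIndependent u → (u∈w : ∀ i → InSpan w (u i)) →
               (k : Fin p) → ¬ (proj₁ (u∈w zero) k ≈ 0#) → suc m ℕ.≤ p
    exchange m (suc p) u w ind u∈w k cₖ≉0 =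
      ℕ.s≤s (steinitz m p (shear u t) (w ∘ punchIn k) (shear-independent u t ind)
        (λ i → InSpan-eliminate w k (u∈w (suc i)) (u∈w zero) (proj₂ (inverse _ cₖ≉0))))
      where
      t : Fin m → Carrier
      t i = - (proj₁ (u∈w (suc i)) k * proj₁ (inverse _ cₖ≉0))

  flatIndex : ∀ h (s : Fin h → ℕ) (l : Fin h) → Fin (s l) → Fin (sumℕ s)
  flatIndex (suc h) s zero    e = e ↑ˡ sumℕ (s ∘ suc)
  flatIndex (suc h) s (suc l) e = s zero ↑ʳ flatIndex h (s ∘ suc) l e

  flatten : ∀ {a} {A : Set a} h (s : Fin h → ℕ) → ((l : Fin h) → Fin (s l) → A) → Fin (sumℕ s) → A
  flatten (suc h) s f i = [ f zero , flatten h (s ∘ suc) (f ∘ suc) ]′ (splitAt (s zero) i)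

  flatten-flatIndex : ∀ {a} {A : Set a} h s (f : (l : Fin h) → Fin (s l) → A) l e →
                      flatten h s f (flatIndex h s l e) ≡ f l e
  flatten-flatIndex (suc h) s f zero e
    rewrite Fin.splitAt-↑ˡ (s zero) e (sumℕ (s ∘ suc)) = ≡.refl
  flatten-flatIndex (suc h) s f (suc l) e
    rewrite Fin.splitAt-↑ʳ (s zero) (sumℕ (s ∘ suc)) (flatIndex h (s ∘ suc) l e) =
    flatten-flatIndex h (s ∘ suc) (f ∘ suc) l e

  flatten-all : ∀ {a p} {A : Set a} {P : A → Set p} h s (f : (l : Fin h) → Fin (s l) → A) →
                (∀ l e → P (f l e)) → ∀ i → P (flatten h s f i)
  flatten-all {P = P} (suc h) s f Pf i with splitAt (s zero) i
  ... | inj₁ e = Pf zero e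
  ... | inj₂ i′ = flatten-all {P = P} h (s ∘ suc) (f ∘ suc) (Pf ∘ suc) i′

  flatIndex-surjective : ∀ h s (i : Fin (sumℕ s)) → Σ (Fin h) λ l → Σ (Fin (s l)) λ e → flatIndex h s l e ≡ i
  flatIndex-surjective (suc h) s i with splitAt (s zero) i in eq
  ... | inj₁ e = zero , e , Fin.splitAt⁻¹-↑ˡ eq
  ... | inj₂ i′ with flatIndex-surjective h (s ∘ suc) i′
  ...   | l , e , ≡i′ = suc l , e , ≡.trans (≡.cong (s zero ↑ʳ_) ≡i′) (Fin.splitAt⁻¹-↑ʳ eq)

  ∑-flatIndex : ∀ h s (f : Fin (sumℕ s) → Carrier) →
                ∑ (sumℕ s) f ≈ ∑ h (λ l → ∑ (s l) (f ∘ flatIndex h s l))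
  ∑-flatIndex zero    s f = refl
  ∑-flatIndex (suc h) s f = trans (∑-++ (s zero) _ f) (+-cong refl (∑-flatIndex h (s ∘ suc) (f ∘ (s zero ↑ʳ_))))

  lincomb₂ : ∀ {h n} (s : Fin h → ℕ) → ((l : Fin h) → Fin (s l) → Carrier) →
             ((l : Fin h) → Fin (s l) → Vect n) → Vect n
  lincomb₂ {h} s co f = ∑ᵥ h (λ l → ∑ᵥ (s l) (λ e → co l e · f l e))

  InSpan₂ : ∀ {h n} (s : Fin h → ℕ) → ((l : Fin h) → Fin (s l) → Vect n) → Vect n → Set (c ⊔ ℓ)
  InSpan₂ s f v = Σ ((l : _) → Fin (s l) → Carrier) λ co → v ≈ᵥ lincomb₂ s co f

  LinearlyIndependent₂ : ∀ {h n} (s : Fin h → ℕ) → ((l : Fin h) → Fin (s l) → Vect n) → Set (c ⊔ ℓ)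
  LinearlyIndependent₂ s f = ∀ co → lincomb₂ s co f ≈ᵥ 0ᵥ → ∀ l e → co l e ≈ 0#

  lincomb-flatten : ∀ {h n} s (co : Fin (sumℕ s) → Carrier) (f : (l : Fin h) → Fin (s l) → Vect n) →
                    lincomb co (flatten h s f) ≈ᵥ lincomb₂ s (λ l e → co (flatIndex h s l e)) f
  lincomb-flatten {h} s co f r = trans (∑-flatIndex h s _)
    (∑-cong h (λ l → ∑-cong (s l) (λ e → *-cong refl (reflexive (≡.cong (λ v → v r) (flatten-flatIndex h s f l e))))))

  InSpan₂⇒InSpan : ∀ {h n} s (f : (l : Fin h) → Fin (s l) → Vect n) {v} →
                   InSpan₂ s f v → InSpan (flatten h s f) v
  InSpan₂⇒InSpan {h} s f (co , v≈) = flatten h s co , λ r → trans (v≈ r) (sym (trans (lincomb-flatten s _ f r)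
    (∑-cong h (λ l → ∑-cong (s l) (λ e → *-cong (reflexive (flatten-flatIndex h s co l e)) refl)))))

  LinearlyIndependent₂⇒LinearlyIndependent : ∀ {h n} s (f : (l : Fin h) → Fin (s l) → Vect n) →
    LinearlyIndependent₂ s f → LinearlyIndependent (flatten h s f)
  LinearlyIndependent₂⇒LinearlyIndependent {h} s f ind co co·f≈0 i with flatIndex-surjective h s i
  ... | l , e , ≡.refl =
    ind (λ l e → co (flatIndex h s l e)) (λ r → trans (sym (lincomb-flatten s co f r)) (co·f≈0 r)) l e

  record IsLinear {m n} (L : Vect m → Vect n) : Set (c ⊔ ℓ) where
    field
      cong              : ∀ {u v} → u ≈ᵥ v → L u ≈ᵥ L v
      preserves-lincomb : ∀ {p} (co : Fin p → Carrier) (w : Fin p → Vect m) →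
                          L (lincomb co w) ≈ᵥ lincomb co (L ∘ w)

  InSpan-map : ∀ {p m n} {L : Vect m → Vect n} → IsLinear L →
               ∀ {w : Fin p → Vect m} {v} → InSpan w v → InSpan (L ∘ w) (L v)
  InSpan-map L-lin (co , v≈) = co , λ r → trans (IsLinear.cong L-lin v≈ r) (IsLinear.preserves-lincomb L-lin co _ r)

  IsLinear-∘ : ∀ {m n p} {L : Vect n → Vect p} {L′ : Vect m → Vect n} →
               IsLinear L → IsLinear L′ → IsLinear (L ∘ L′)
  IsLinear-∘ L-lin L′-lin = record
    { cong              = IsLinear.cong L-lin ∘ IsLinear.cong L′-lin
    ; preserves-lincomb = λ co w r → trans (IsLinear.cong L-lin (IsLinear.preserves-lincomb L′-lin co w) r)
                                           (IsLinear.preserves-lincomb L-lin co _ r)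
    }

  ⊛-cong : ∀ {m n} (B : Mat m n) {u v} → u ≈ᵥ v → (B ⊛ u) ≈ᵥ (B ⊛ v)
  ⊛-cong {n = n} B u≈v r = ∑-cong n (λ j → *-cong refl (u≈v j))

  ⊛-isLinear : ∀ {m n} (B : Mat m n) → IsLinear (B ⊛_)
  ⊛-isLinear {n = n} B = record { cong = ⊛-cong B ; preserves-lincomb = ⊛-lincomb }
    where
    ⊛-lincomb : ∀ {p} (co : Fin p → Carrier) w → (B ⊛ lincomb co w) ≈ᵥ lincomb co ((B ⊛_) ∘ w)
    ⊛-lincomb {p} co w r = begin
      ∑ n (λ k → B r k * ∑ p (λ j → co j * w j k))
        ≈⟨ ∑-cong n (λ k → trans (*-distribˡ-∑ p (B r k) _)
                                 (∑-cong p (λ j → x*[y*z]≈y*[x*z] (B r k) (co j) (w j k)))) ⟩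
      ∑ n (λ k → ∑ p (λ j → co j * (B r k * w j k)))
        ≈⟨ ∑-comm n p _ ⟩
      ∑ p (λ j → ∑ n (λ k → co j * (B r k * w j k)))
        ≈⟨ ∑-cong p (λ j → sym (*-distribˡ-∑ n (co j) _)) ⟩
      lincomb co ((B ⊛_) ∘ w) r ∎
      where
      x*[y*z]≈y*[x*z] : ∀ x y z → x * (y * z) ≈ y * (x * z)
      x*[y*z]≈y*[x*z] = solve 3 (λ x y z → x :* (y :* z) := y :* (x :* z)) refl

  ⊛-∑ᵥ : ∀ {m n} p (B : Mat m n) (vs : Fin p → Vect n) → (B ⊛ ∑ᵥ p vs) ≈ᵥ ∑ᵥ p ((B ⊛_) ∘ vs)
  ⊛-∑ᵥ {n = n} p B vs r = trans (∑-cong n (λ k → *-distribˡ-∑ p (B r k) _)) (∑-comm n p _)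

  ⊛-· : ∀ {m n} (B : Mat m n) a (v : Vect n) → (B ⊛ (a · v)) ≈ᵥ (a · (B ⊛ v))
  ⊛-· {n = n} B a v r =
    trans (∑-cong n (λ k → solve 3 (λ b a x → b :* (a :* x) := a :* (b :* x)) refl (B r k) a (v k)))
          (sym (*-distribˡ-∑ n a _))

  ∑-cast : ∀ {m n} (eq : m ≡ n) (f : Fin n → Carrier) → ∑ n f ≈ ∑ m (f ∘ Fin.cast eq)
  ∑-cast {m} ≡.refl f = ∑-cong m (λ k → reflexive (≡.cong f (≡.sym (Fin.cast-is-id ≡.refl k))))

  ≈ᵥ-++ : ∀ {p q} {u v : Vect (p ℕ.+ q)} →
          (∀ i → u (i ↑ˡ q) ≈ v (i ↑ˡ q)) → (∀ j → u (p ↑ʳ j) ≈ v (p ↑ʳ j)) → u ≈ᵥ v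
  ≈ᵥ-++ {p} {q} {u} {v} left right k with splitAt p k in eq
  ... | inj₁ i = ≡.subst (λ k → u k ≈ v k) (Fin.splitAt⁻¹-↑ˡ eq) (left i)
  ... | inj₂ j = ≡.subst (λ k → u k ≈ v k) (Fin.splitAt⁻¹-↑ʳ eq) (right j)

  reindex-isLinear : ∀ {m n} (π : Fin n → Fin m) → IsLinear (_∘ π)
  reindex-isLinear π = record { cong = λ u≈v → u≈v ∘ π ; preserves-lincomb = λ _ _ _ → refl }

  ++-cong : ∀ {p q} {u u′ : Vect p} {v v′ : Vect q} → u ≈ᵥ u′ → v ≈ᵥ v′ → (u ++ v) ≈ᵥ (u′ ++ v′)
  ++-cong {u = u} {u′} {v} {v′} u≈u′ v≈v′ = ≈ᵥ-++
    (λ i → trans (reflexive (lookup-++ˡ u v i)) (trans (u≈u′ i) (reflexive (≡.sym (lookup-++ˡ u′ v′ i)))))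
    (λ j → trans (reflexive (lookup-++ʳ u v j)) (trans (v≈v′ j) (reflexive (≡.sym (lookup-++ʳ u′ v′ j)))))

  lincomb-++ : ∀ {r p q} (co : Fin r → Carrier) (u : Fin r → Vect p) (v : Fin r → Vect q) →
               lincomb co (λ j → u j ++ v j) ≈ᵥ (lincomb co u ++ lincomb co v)
  lincomb-++ {r} co u v = ≈ᵥ-++
    (λ i → trans (∑-cong r (λ j → *-cong refl (reflexive (lookup-++ˡ (u j) (v j) i))))
                 (reflexive (≡.sym (lookup-++ˡ (lincomb co u) (lincomb co v) i))))
    (λ i → trans (∑-cong r (λ j → *-cong refl (reflexive (lookup-++ʳ (u j) (v j) i))))
                 (reflexive (≡.sym (lookup-++ʳ (lincomb co u) (lincomb co v) i))))

  lincomb-0ᵥ : ∀ {r n} (co : Fin r → Carrier) → lincomb co (λ _ → 0ᵥ {n}) ≈ᵥ 0ᵥ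
  lincomb-0ᵥ {r} co i = ∑-zero r (λ _ → zeroʳ _)

  padʳ-isLinear : ∀ {p q} → IsLinear (λ (u : Vect p) → u ++ 0ᵥ {q})
  padʳ-isLinear {p} = record
    { cong              = λ u≈v → ++-cong u≈v (λ _ → refl)
    ; preserves-lincomb = λ co w k →
        sym (trans (lincomb-++ co w (λ _ → 0ᵥ) k) (++-cong {p} (λ _ → refl) (lincomb-0ᵥ co) k))
    }

  padˡ-isLinear : ∀ {p q} → IsLinear (λ (u : Vect q) → 0ᵥ {p} ++ u)
  padˡ-isLinear {p} = record
    { cong              = λ u≈v → ++-cong (λ _ → refl) u≈v
    ; preserves-lincomb = λ co w k →
        sym (trans (lincomb-++ co (λ _ → 0ᵥ) w k) (++-cong {p} (lincomb-0ᵥ co) (λ _ → refl) k))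
    }

  InSpan-lastColumns : ∀ {m p q} (B : Mat m (p ℕ.+ q)) → (∀ r i → B r (i ↑ˡ q) ≈ 0#) →
                       ∀ v → InSpan (λ j r → B r (p ↑ʳ j)) (B ⊛ v)
  InSpan-lastColumns {p = p} {q} B firstColumns≈0 v = (λ j → v (p ↑ʳ j)) , λ r → begin
    (B ⊛ v) r
      ≈⟨ ∑-++ p q (λ k → B r k * v k) ⟩
    ∑ p (λ i → B r (i ↑ˡ q) * v (i ↑ˡ q)) + ∑ q (λ j → B r (p ↑ʳ j) * v (p ↑ʳ j))
      ≈⟨ +-cong (∑-zero p (λ i → trans (*-cong (firstColumns≈0 r i) refl) (zeroˡ _))) (∑-cong q (λ j → *-comm _ _)) ⟩
    0# + lincomb (λ j → v (p ↑ʳ j)) (λ j r → B r (p ↑ʳ j)) r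
      ≈⟨ +-identityˡ _ ⟩
    lincomb (λ j → v (p ↑ʳ j)) (λ j r → B r (p ↑ʳ j)) r ∎

  independent₂-size≤ : ∀ {h n q} (s : Fin h → ℕ) (f : (l : Fin h) → Fin (s l) → Vect n) (w : Fin q → Vect n) →
                       LinearlyIndependent₂ s f → (∀ l e → InSpan w (f l e)) → sumℕ s ℕ.≤ q
  independent₂-size≤ {h} {q = q} s f w ind f∈w =
    steinitz _ q (flatten h s f) w (LinearlyIndependent₂⇒LinearlyIndependent s f ind)
                 (flatten-all {P = InSpan w} h s f f∈w)

  pow-⊛ : ∀ {m} (B : Mat m m) k v → pow B k (B ⊛ v) ≡ pow B (suc k) v
  pow-⊛ B zero    v = ≡.refl
  pow-⊛ B (suc k) v = ≡.cong (B ⊛_) (pow-⊛ B k v)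

  krylov : ∀ {h m} (B : Mat m m) (s : Fin h → ℕ) (x : Fin h → Vect m) (l : Fin h) → Fin (s l) → Vect m
  krylov B s x l e = pow B (toℕ e) (x l)

  krylov-⊛-independent : ∀ {h m} (B : Mat m m) (s : Fin h → ℕ) (x : Fin h → Vect m) →
    LinearlyIndependent₂ s (krylov B s x) →
    LinearlyIndependent₂ (λ l → s l ∸ 1) (krylov B (λ l → s l ∸ 1) ((B ⊛_) ∘ x))
  krylov-⊛-independent {h} {m} B s x ind co co·f≈0 l e = shift-coeff (s l) (co l) e (ind co′ co′·f≈0 l (suc′ (s l) e))
    where
    -- A relation among the B^e (B x_l) is a relation among the B^(e+1) x_l.
    suc′ : ∀ k → Fin (k ∸ 1) → Fin k
    suc′ (suc k) e = suc e
    shift : ∀ k → (Fin (k ∸ 1) → Carrier) → Fin k → Carrier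
    shift (suc k) d zero    = 0#
    shift (suc k) d (suc e) = d e
    shift-coeff : ∀ k d e → shift k d (suc′ k e) ≈ 0# → d e ≈ 0#
    shift-coeff (suc k) d e d≈0 = d≈0
    co′ : (l : Fin h) → Fin (s l) → Carrier
    co′ l = shift (s l) (co l)
    ∑-shift : ∀ k (d : Fin (k ∸ 1) → Carrier) (y : Vect m) r →
      ∑ k (λ e → shift k d e * pow B (toℕ e) y r) ≈ ∑ (k ∸ 1) (λ e → d e * pow B (toℕ e) (B ⊛ y) r)
    ∑-shift zero    d y r = refl
    ∑-shift (suc k) d y r = trans (trans (+-cong (zeroˡ _) refl) (+-identityˡ _))
      (∑-cong k (λ e → *-cong refl (reflexive (≡.cong (λ v → v r) (≡.sym (pow-⊛ B (toℕ e) y))))))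
    co′·f≈0 : lincomb₂ s co′ (krylov B s x) ≈ᵥ 0ᵥ
    co′·f≈0 r = trans (∑-cong h (λ l → ∑-shift (s l) (co l) (x l) r)) (co·f≈0 r)

  InSpan₂-krylov-⊛ : ∀ {h m} (B : Mat m m) (s : Fin h → ℕ) (x : Fin h → Vect m) →
    (∀ l → pow B (s l) (x l) ≈ᵥ 0ᵥ) →
    ∀ {v} → InSpan₂ s (krylov B s x) v → InSpan₂ (λ l → s l ∸ 1) (krylov B (λ l → s l ∸ 1) ((B ⊛_) ∘ x)) (B ⊛ v)
  InSpan₂-krylov-⊛ {h} B s x Bˢx≈0 {v} (co , v≈) = (λ l → drop-last (s l) (co l)) , λ r → begin
    (B ⊛ v) r
      ≈⟨ ⊛-cong B v≈ r ⟩
    (B ⊛ lincomb₂ s co (krylov B s x)) r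
      ≈⟨ ⊛-∑ᵥ h B _ r ⟩
    ∑ h (λ l → (B ⊛ ∑ᵥ (s l) (λ e → co l e · krylov B s x l e)) r)
      ≈⟨ ∑-cong h (λ l → trans (⊛-∑ᵥ (s l) B _ r) (∑-cong (s l) (λ e → ⊛-· B (co l e) _ r))) ⟩
    ∑ h (λ l → ∑ (s l) (λ e → co l e * (B ⊛ pow B (toℕ e) (x l)) r))
      ≈⟨ ∑-cong h (λ l → ∑-⊛-krylov (s l) (co l) (x l) (Bˢx≈0 l) r) ⟩
    lincomb₂ (λ l → s l ∸ 1) (λ l → drop-last (s l) (co l)) (krylov B (λ l → s l ∸ 1) ((B ⊛_) ∘ x)) r ∎
    where
    drop-last : ∀ k → (Fin k → Carrier) → Fin (k ∸ 1) → Carrier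
    drop-last (suc k) d = d ∘ inject₁
    -- The top coefficient is killed by B^k y = 0.
    ∑-⊛-krylov : ∀ k (d : Fin k → Carrier) y → pow B k y ≈ᵥ 0ᵥ → ∀ r →
      ∑ k (λ e → d e * (B ⊛ pow B (toℕ e) y) r) ≈ ∑ (k ∸ 1) (λ e → drop-last k d e * pow B (toℕ e) (B ⊛ y) r)
    ∑-⊛-krylov zero    d y _     r = refl
    ∑-⊛-krylov (suc k) d y Bᵏy≈0 r = begin
      ∑ (suc k) (λ e → d e * (B ⊛ pow B (toℕ e) y) r)
        ≈⟨ ∑-init-last k (λ e → d e * (B ⊛ pow B (toℕ e) y) r) ⟩
      ∑ k (λ e → d (inject₁ e) * (B ⊛ pow B (toℕ (inject₁ e)) y) r) + d (fromℕ k) * (B ⊛ pow B (toℕ (fromℕ k)) y) r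
        ≈⟨ +-cong (∑-cong k (λ e → *-cong refl (reflexive (≡.cong (λ t → (B ⊛ pow B t y) r) (Fin.toℕ-inject₁ e)))))
                  (trans (*-cong refl (trans (reflexive (≡.cong (λ t → (B ⊛ pow B t y) r) (Fin.toℕ-fromℕ k))) (Bᵏy≈0 r)))
                         (zeroʳ _)) ⟩
      ∑ k (λ e → d (inject₁ e) * (B ⊛ pow B (toℕ e) y) r) + 0#
        ≈⟨ +-identityʳ _ ⟩
      ∑ k (λ e → d (inject₁ e) * (B ⊛ pow B (toℕ e) y) r)
        ≈⟨ ∑-cong k (λ e → *-cong refl (reflexive (≡.cong (λ v → v r) (≡.sym (pow-⊛ B (toℕ e) y))))) ⟩
      ∑ k (λ e → d (inject₁ e) * pow B (toℕ e) (B ⊛ y) r) ∎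

  krylov-size≡dim : ∀ {h m} (B : Mat m m) (s : Fin h → ℕ) (x : Fin h → Vect m) →
    LinearlyIndependent₂ s (krylov B s x) → (∀ v → InSpan₂ s (krylov B s x) v) → sumℕ s ≡ m
  krylov-size≡dim {h} {m} B s x ind spans = ℕ.≤-antisym
    (independent₂-size≤ s (krylov B s x) standardBasis ind (λ l e → InSpan-standardBasis _))
    (steinitz m _ standardBasis (flatten h s (krylov B s x)) standardBasis-independent
      (λ i → InSpan₂⇒InSpan s _ (spans (standardBasis i))))

  rank-⊛≤ : ∀ {h m q} (B : Mat m m) (s : Fin h → ℕ) (x : Fin h → Vect m) (w : Fin q → Vect m) →
    LinearlyIndependent₂ s (krylov B s x) → (∀ v → InSpan w (B ⊛ v)) → sumℕ (λ l → s l ∸ 1) ℕ.≤ q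
  rank-⊛≤ B s x w ind img⊆w = independent₂-size≤ _ _ w (krylov-⊛-independent B s x ind)
    (λ l e → InSpan-resp-≈ᵥ (img⊆w (pow B (toℕ e) (x l)))
                            (λ r → reflexive (≡.cong (λ v → v r) (pow-⊛ B (toℕ e) (x l)))))

  rank-⊛²≤ : ∀ {h m q} (B : Mat m m) (s : Fin h → ℕ) (x : Fin h → Vect m) (w : Fin q → Vect m) →
    LinearlyIndependent₂ s (krylov B s x) → (∀ v → InSpan w (B ⊛ (B ⊛ v))) → sumℕ (λ l → s l ∸ 2) ℕ.≤ q
  rank-⊛²≤ {q = q} B s x w ind img⊆w =
    ≡.subst (ℕ._≤ q) (ℕ-Sum.sum-cong-≗ (λ l → ℕ.∸-+-assoc (s l) 1 1))
      (independent₂-size≤ _ _ w (krylov-⊛-independent B _ ((B ⊛_) ∘ x) (krylov-⊛-independent B s x ind))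
        (λ l e → InSpan-resp-≈ᵥ (img⊆w (pow B (toℕ e) (x l))) (λ r → reflexive (≡.cong (λ v → v r)
          (≡.trans (pow-⊛ B (toℕ e) (B ⊛ x l)) (≡.cong (B ⊛_) (pow-⊛ B (toℕ e) (x l))))))))

  InSpan-image-krylov : ∀ {h m} (B : Mat m m) (s : Fin h → ℕ) (x : Fin h → Vect m) →
    (∀ l → pow B (s l) (x l) ≈ᵥ 0ᵥ) → (∀ v → InSpan₂ s (krylov B s x) v) →
    ∀ v → InSpan (flatten h (λ l → s l ∸ 1) (krylov B (λ l → s l ∸ 1) ((B ⊛_) ∘ x))) (B ⊛ v)
  InSpan-image-krylov B s x Bˢx≈0 spans v = InSpan₂⇒InSpan _ _ (InSpan₂-krylov-⊛ B s x Bˢx≈0 (spans v))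

<ᵇ-true : ∀ {m n} → m ℕ.< n → (m <ᵇ n) ≡ true
<ᵇ-true m<n = Equivalence.to T-≡ (ℕ.<⇒<ᵇ m<n)

<ᵇ-false : ∀ {m n} → n ℕ.≤ m → (m <ᵇ n) ≡ false
<ᵇ-false {m} {n} n≤m = ¬-not (λ m<ᵇn → ℕ.<⇒≱ (ℕ.<ᵇ⇒< m n (Equivalence.from T-≡ m<ᵇn)) n≤m)

module LayerProperties (d₁ d₂ : ℕ) where

  layer-<d₁ : ∀ {r} → r ℕ.< d₁ → layer d₁ d₂ r ≡ 1
  layer-<d₁ r<d₁ rewrite <ᵇ-true r<d₁ = ≡.refl

  layer-≥d₁+d₂ : ∀ {r} → d₁ ℕ.+ d₂ ℕ.≤ r → layer d₁ d₂ r ≡ 3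
  layer-≥d₁+d₂ d₁₂≤r rewrite <ᵇ-false (ℕ.≤-trans (ℕ.m≤m+n d₁ d₂) d₁₂≤r) | <ᵇ-false d₁₂≤r = ≡.refl

  layer-<d₁+d₂ : ∀ {r} → r ℕ.< d₁ ℕ.+ d₂ → layer d₁ d₂ r ℕ.≤ 2
  layer-<d₁+d₂ {r} r<d₁₂ with r <ᵇ d₁
  ... | true  = ℕ.s≤s ℕ.z≤n
  ... | false rewrite <ᵇ-true r<d₁₂ = ℕ.≤-refl

  layer-≥d₁ : ∀ {r} → d₁ ℕ.≤ r → 2 ℕ.≤ layer d₁ d₂ r
  layer-≥d₁ {r} d₁≤r rewrite <ᵇ-false d₁≤r with r <ᵇ d₁ ℕ.+ d₂
  ... | true  = ℕ.≤-refl
  ... | false = ℕ.s≤s (ℕ.s≤s ℕ.z≤n)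

  1≤layer : ∀ r → 1 ℕ.≤ layer d₁ d₂ r
  1≤layer r with r <ᵇ d₁ | r <ᵇ d₁ ℕ.+ d₂
  ... | true  | _     = ℕ.s≤s ℕ.z≤n
  ... | false | true  = ℕ.s≤s ℕ.z≤n
  ... | false | false = ℕ.s≤s ℕ.z≤n

  layer≤3 : ∀ r → layer d₁ d₂ r ℕ.≤ 3
  layer≤3 r with r <ᵇ d₁ | r <ᵇ d₁ ℕ.+ d₂
  ... | true  | _     = ℕ.s≤s ℕ.z≤n
  ... | false | true  = ℕ.s≤s (ℕ.s≤s ℕ.z≤n)
  ... | false | false = ℕ.≤-refl

record RankInequalities (h d₁ d₂ d₃ : ℕ) (a b e : Fin h → ℕ) : Set where
  field
    dim-M             : sumℕ a ≡ d₁ ℕ.+ d₂ ℕ.+ d₃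
    dim-M₂            : sumℕ b ≡ d₁ ℕ.+ d₂
    dim-M/M₁          : sumℕ e ≡ d₂ ℕ.+ d₃
    rank-T₂≤d₂        : sumℕ (λ l → b l ∸ 1) ℕ.≤ d₂
    rank-T̄≤d₃         : sumℕ (λ l → e l ∸ 1) ℕ.≤ d₃
    rank-T≤rank-T₂+d₃ : sumℕ (λ l → a l ∸ 1) ℕ.≤ sumℕ (λ l → b l ∸ 1) ℕ.+ d₃
    rank-T²≤rank-T₂   : sumℕ (λ l → a l ∸ 2) ℕ.≤ sumℕ (λ l → b l ∸ 1)
    rank-T≤rank-T̄+d₁  : sumℕ (λ l → a l ∸ 1) ℕ.≤ sumℕ (λ l → e l ∸ 1) ℕ.+ d₁
    rank-T²≤rank-T̄    : sumℕ (λ l → a l ∸ 2) ℕ.≤ sumℕ (λ l → e l ∸ 1)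

module PRDatum {c ℓ : Level} (F : Field c ℓ) (d₁ d₂ d₃ : ℕ)
  (A : LinAlg.Mat F (d₁ ℕ.+ d₂ ℕ.+ d₃) (d₁ ℕ.+ d₂ ℕ.+ d₃)) (pr : PR.IsPRDatum F d₁ d₂ d₃ A) where
  open Field F hiding (zero)
  open LinAlg F
  open LinearAlgebra F
  open LayerProperties d₁ d₂
  open import Relation.Binary.Reasoning.Setoid setoid

  n : ℕ
  n = d₁ ℕ.+ d₂ ℕ.+ d₃

  assoc : n ≡ d₁ ℕ.+ (d₂ ℕ.+ d₃)
  assoc = ℕ.+-assoc d₁ d₂ d₃

  A₂ : Mat (d₁ ℕ.+ d₂) (d₁ ℕ.+ d₂)
  A₂ = PR.onM₂ F d₁ d₂ d₃ A

  Ā : Mat (d₂ ℕ.+ d₃) (d₂ ℕ.+ d₃)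
  Ā = PR.onM/M₁ F d₁ d₂ d₃ A

  idx₁ : Fin d₁ → Fin n
  idx₁ x = cast (≡.sym assoc) (x ↑ˡ (d₂ ℕ.+ d₃))

  idxQ : Fin (d₂ ℕ.+ d₃) → Fin n
  idxQ = PR.quotIdx F d₁ d₂ d₃

  idx₃ : Fin d₃ → Fin n
  idx₃ z = (d₁ ℕ.+ d₂) ↑ʳ z

  toℕ-idx₁ : ∀ x → toℕ (idx₁ x) ≡ toℕ x
  toℕ-idx₁ x = ≡.trans (Fin.toℕ-cast _ _) (Fin.toℕ-↑ˡ x _)

  toℕ-idxQ : ∀ i → toℕ (idxQ i) ≡ d₁ ℕ.+ toℕ i
  toℕ-idxQ i = ≡.trans (Fin.toℕ-cast _ _) (Fin.toℕ-↑ʳ d₁ i)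

  A-column₁≈0 : ∀ row col → toℕ col ℕ.< d₁ → A row col ≈ 0#
  A-column₁≈0 row col col<d₁ =
    pr row col (≡.subst (ℕ._≤ layer d₁ d₂ (toℕ row)) (≡.sym (layer-<d₁ col<d₁)) (1≤layer (toℕ row)))

  A-row₃≈0 : ∀ row col → d₁ ℕ.+ d₂ ℕ.≤ toℕ row → A row col ≈ 0#
  A-row₃≈0 row col d₁₂≤row =
    pr row col (≡.subst (layer d₁ d₂ (toℕ col) ℕ.≤_) (≡.sym (layer-≥d₁+d₂ d₁₂≤row)) (layer≤3 (toℕ col)))

  A-rowQ-column₂≈0 : ∀ row col → d₁ ℕ.≤ toℕ row → toℕ col ℕ.< d₁ ℕ.+ d₂ → A row col ≈ 0#
  A-rowQ-column₂≈0 row col d₁≤row col<d₁₂ = pr row col (ℕ.≤-trans (layer-<d₁+d₂ col<d₁₂) (layer-≥d₁ d₁≤row))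

  A-idx₁≈0 : ∀ {row} x → A row (idx₁ x) ≈ 0#
  A-idx₁≈0 {row} x = A-column₁≈0 row (idx₁ x) (≡.subst (ℕ._< d₁) (≡.sym (toℕ-idx₁ x)) (Fin.toℕ<n x))

  A-idx₃≈0 : ∀ z col → A (idx₃ z) col ≈ 0#
  A-idx₃≈0 z col =
    A-row₃≈0 (idx₃ z) col (≡.subst (d₁ ℕ.+ d₂ ℕ.≤_) (≡.sym (Fin.toℕ-↑ʳ (d₁ ℕ.+ d₂) z)) (ℕ.m≤m+n _ _))

  A₂-column₁≈0 : ∀ r x → A₂ r (x ↑ˡ d₂) ≈ 0#
  A₂-column₁≈0 r x = A-column₁≈0 (r ↑ˡ d₃) ((x ↑ˡ d₂) ↑ˡ d₃)
    (≡.subst (ℕ._< d₁) (≡.sym (≡.trans (Fin.toℕ-↑ˡ _ d₃) (Fin.toℕ-↑ˡ x d₂))) (Fin.toℕ<n x))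

  Ā-column₂≈0 : ∀ i y → Ā i (y ↑ˡ d₃) ≈ 0#
  Ā-column₂≈0 i y = A-rowQ-column₂≈0 (idxQ i) (idxQ (y ↑ˡ d₃))
    (≡.subst (d₁ ℕ.≤_) (≡.sym (toℕ-idxQ i)) (ℕ.m≤m+n _ _))
    (≡.subst (ℕ._< d₁ ℕ.+ d₂) (≡.sym (≡.trans (toℕ-idxQ _) (≡.cong (d₁ ℕ.+_) (Fin.toℕ-↑ˡ y d₃))))
      (ℕ.+-monoʳ-< d₁ (Fin.toℕ<n y)))

  ⊛-idx₃≈0 : ∀ w z → (A ⊛ w) (idx₃ z) ≈ 0#
  ⊛-idx₃≈0 w z = ∑-zero n (λ k → trans (*-cong (A-idx₃≈0 z k) refl) (zeroˡ _))

  ∑-M₁-M/M₁ : ∀ (f : Fin n → Carrier) → ∑ n f ≈ ∑ d₁ (f ∘ idx₁) + ∑ (d₂ ℕ.+ d₃) (f ∘ idxQ)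
  ∑-M₁-M/M₁ f = trans (∑-cast (≡.sym assoc) f) (∑-++ d₁ (d₂ ℕ.+ d₃) _)

  ≈ᵥ-M₁-M/M₁ : ∀ {u v : Vect n} →
               (∀ x → u (idx₁ x) ≈ v (idx₁ x)) → (∀ i → u (idxQ i) ≈ v (idxQ i)) → u ≈ᵥ v
  ≈ᵥ-M₁-M/M₁ {u} {v} on-M₁ on-M/M₁ k =
    ≡.subst (λ k → u k ≈ v k) (Fin.cast-involutive (≡.sym assoc) assoc k)
      (≈ᵥ-++ {d₁} {d₂ ℕ.+ d₃} {u ∘ cast (≡.sym assoc)} {v ∘ cast (≡.sym assoc)} on-M₁ on-M/M₁ (cast assoc k))

  ⊛-ignores-M₁ : ∀ v r → (A ⊛ v) r ≈ ∑ (d₂ ℕ.+ d₃) (λ j → A r (idxQ j) * v (idxQ j))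
  ⊛-ignores-M₁ v r = begin
    (A ⊛ v) r
      ≈⟨ ∑-M₁-M/M₁ (λ k → A r k * v k) ⟩
    ∑ d₁ (λ x → A r (idx₁ x) * v (idx₁ x)) + ∑ (d₂ ℕ.+ d₃) (λ j → A r (idxQ j) * v (idxQ j))
      ≈⟨ +-cong (∑-zero d₁ (λ x → trans (*-cong (A-idx₁≈0 x) refl) (zeroˡ _))) refl ⟩
    0# + ∑ (d₂ ℕ.+ d₃) (λ j → A r (idxQ j) * v (idxQ j))
      ≈⟨ +-identityˡ _ ⟩
    ∑ (d₂ ℕ.+ d₃) (λ j → A r (idxQ j) * v (idxQ j)) ∎

  ⊛-idxQ : ∀ w i → (A ⊛ w) (idxQ i) ≈ (Ā ⊛ (w ∘ idxQ)) i
  ⊛-idxQ w i = ⊛-ignores-M₁ w (idxQ i)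

  -- The inclusion M₂ → M, the inclusion of the coordinates of M₁, and a section M/M₁ → M.
  ι : Vect (d₁ ℕ.+ d₂) → Vect n
  ι u = u ++ 0ᵥ

  τ : Vect d₁ → Vect n
  τ u = (u ++ 0ᵥ {d₂ ℕ.+ d₃}) ∘ cast assoc

  σ : Vect (d₂ ℕ.+ d₃) → Vect n
  σ u = (0ᵥ {d₁} ++ u) ∘ cast assoc

  ι-isLinear : IsLinear ι
  ι-isLinear = padʳ-isLinear

  τ-isLinear : IsLinear τ
  τ-isLinear = IsLinear-∘ (reindex-isLinear (cast assoc)) padʳ-isLinear

  σ-isLinear : IsLinear σ
  σ-isLinear = IsLinear-∘ (reindex-isLinear (cast assoc)) (padˡ-isLinear {d₁})

  ++-idx₁ : ∀ (u : Vect d₁) (v : Vect (d₂ ℕ.+ d₃)) x → (u ++ v) (cast assoc (idx₁ x)) ≡ u x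
  ++-idx₁ u v x = ≡.trans (≡.cong (u ++ v) (Fin.cast-involutive assoc (≡.sym assoc) _)) (lookup-++ˡ u v x)

  ++-idxQ : ∀ (u : Vect d₁) (v : Vect (d₂ ℕ.+ d₃)) i → (u ++ v) (cast assoc (idxQ i)) ≡ v i
  ++-idxQ u v i = ≡.trans (≡.cong (u ++ v) (Fin.cast-involutive assoc (≡.sym assoc) _)) (lookup-++ʳ u v i)

  column₃ : Fin d₃ → Vect n
  column₃ z k = A k (idx₃ z)

  ⊛-via-M₂ : ∀ w → (A ⊛ w) ≈ᵥ (ι (A₂ ⊛ (w ∘ (_↑ˡ d₃))) +ᵥ lincomb (w ∘ idx₃) column₃)
  ⊛-via-M₂ w = ≈ᵥ-++ {d₁ ℕ.+ d₂} {d₃} on-M₂ on-layer₃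
    where
    on-M₂ : ∀ r → (A ⊛ w) (r ↑ˡ d₃) ≈ (ι (A₂ ⊛ (w ∘ (_↑ˡ d₃))) +ᵥ lincomb (w ∘ idx₃) column₃) (r ↑ˡ d₃)
    on-M₂ r = trans (∑-++ (d₁ ℕ.+ d₂) d₃ _)
      (+-cong (reflexive (≡.sym (lookup-++ˡ (A₂ ⊛ (w ∘ (_↑ˡ d₃))) 0ᵥ r))) (∑-cong d₃ (λ z → *-comm _ _)))
    on-layer₃ : ∀ z → (A ⊛ w) (idx₃ z) ≈ (ι (A₂ ⊛ (w ∘ (_↑ˡ d₃))) +ᵥ lincomb (w ∘ idx₃) column₃) (idx₃ z)
    on-layer₃ z = sym (begin
      ι (A₂ ⊛ (w ∘ (_↑ˡ d₃))) (idx₃ z) + lincomb (w ∘ idx₃) column₃ (idx₃ z)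
        ≈⟨ +-cong (reflexive (lookup-++ʳ (A₂ ⊛ (w ∘ (_↑ˡ d₃))) 0ᵥ z))
                  (∑-zero d₃ (λ z′ → trans (*-cong refl (A-idx₃≈0 z _)) (zeroʳ _))) ⟩
      0# + 0#
        ≈⟨ +-identityʳ 0# ⟩
      0#
        ≈⟨ sym (⊛-idx₃≈0 w z) ⟩
      (A ⊛ w) (idx₃ z) ∎)

  ⊛²-via-M₂ : ∀ w → (A ⊛ (A ⊛ w)) ≈ᵥ ι (A₂ ⊛ ((A ⊛ w) ∘ (_↑ˡ d₃)))
  ⊛²-via-M₂ w k = trans (⊛-via-M₂ (A ⊛ w) k)
    (trans (+-cong refl (lincomb-zero _ column₃ (⊛-idx₃≈0 w) k)) (+-identityʳ _))

  ⊛-via-M/M₁ : ∀ w → (A ⊛ w) ≈ᵥ (σ (Ā ⊛ (w ∘ idxQ)) +ᵥ τ ((A ⊛ w) ∘ idx₁))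
  ⊛-via-M/M₁ w = ≈ᵥ-M₁-M/M₁
    (λ x → sym (trans (+-cong (reflexive (++-idx₁ 0ᵥ (Ā ⊛ (w ∘ idxQ)) x)) (reflexive (++-idx₁ ((A ⊛ w) ∘ idx₁) 0ᵥ x)))
                      (+-identityˡ _)))
    (λ i → sym (trans (+-cong (reflexive (++-idxQ 0ᵥ (Ā ⊛ (w ∘ idxQ)) i)) (reflexive (++-idxQ ((A ⊛ w) ∘ idx₁) 0ᵥ i)))
                      (trans (+-identityʳ _) (sym (⊛-idxQ w i)))))

  ⊛²-via-M/M₁ : ∀ w → (A ⊛ (A ⊛ w)) ≈ᵥ (A ⊛ σ (Ā ⊛ (w ∘ idxQ)))
  ⊛²-via-M/M₁ w r = trans (⊛-ignores-M₁ (A ⊛ w) r)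
    (trans (∑-cong (d₂ ℕ.+ d₃) (λ j → *-cong refl (trans (⊛-idxQ w j) (reflexive (≡.sym (++-idxQ 0ᵥ _ j))))))
           (sym (⊛-ignores-M₁ (σ (Ā ⊛ (w ∘ idxQ))) r)))

  rankInequalities : ∀ {h} (a b e : Fin h → ℕ) →
    IsCyclicDecomp h A a → IsCyclicDecomp h A₂ b → IsCyclicDecomp h Ā e → RankInequalities h d₁ d₂ d₃ a b e
  rankInequalities {h} a b e (g , _ , spans , ind) (g₂ , A₂ᵇg₂≈0 , spans₂ , ind₂) (ḡ , Āᵉḡ≈0 , spansQ , indQ) = record
    { dim-M             = krylov-size≡dim A a g ind spans
    ; dim-M₂            = krylov-size≡dim A₂ b g₂ ind₂ spans₂
    ; dim-M/M₁          = krylov-size≡dim Ā e ḡ indQ spansQ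
    ; rank-T₂≤d₂        = rank-⊛≤ A₂ b g₂ _ ind₂ (InSpan-lastColumns A₂ A₂-column₁≈0)
    ; rank-T̄≤d₃         = rank-⊛≤ Ā e ḡ _ indQ (InSpan-lastColumns Ā Ā-column₂≈0)
    ; rank-T≤rank-T₂+d₃ = rank-⊛≤ A a g _ ind λ w →
        InSpan-resp-≈ᵥ (InSpan-++ (InSpan-map ι-isLinear (image₂ _)) ((w ∘ idx₃) , λ _ → refl)) (⊛-via-M₂ w)
    ; rank-T²≤rank-T₂   = rank-⊛²≤ A a g _ ind λ w →
        InSpan-resp-≈ᵥ (InSpan-map ι-isLinear (image₂ _)) (⊛²-via-M₂ w)
    ; rank-T≤rank-T̄+d₁  = rank-⊛≤ A a g _ ind λ w →
        InSpan-resp-≈ᵥ (InSpan-++ (InSpan-map σ-isLinear (imageQ _)) (InSpan-map τ-isLinear (InSpan-standardBasis _)))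
                       (⊛-via-M/M₁ w)
    ; rank-T²≤rank-T̄    = rank-⊛²≤ A a g _ ind λ w →
        InSpan-resp-≈ᵥ (InSpan-map (IsLinear-∘ (⊛-isLinear A) σ-isLinear) (imageQ _)) (⊛²-via-M/M₁ w)
    }
    where
    image₂ : ∀ u → InSpan (flatten h (λ l → b l ∸ 1) (krylov A₂ (λ l → b l ∸ 1) ((A₂ ⊛_) ∘ g₂))) (A₂ ⊛ u)
    image₂ = InSpan-image-krylov A₂ b g₂ A₂ᵇg₂≈0 spans₂
    imageQ : ∀ u → InSpan (flatten h (λ l → e l ∸ 1) (krylov Ā (λ l → e l ∸ 1) ((Ā ⊛_) ∘ ḡ))) (Ā ⊛ u)
    imageQ = InSpan-image-krylov Ā e ḡ Āᵉḡ≈0 spansQ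

module Polygons where
  open import Algebra.Bundles using (Ring; CommutativeRing)
  open import Data.Bool using (T; true; false; if_then_else_)
  open import Data.Nat using (_≤ᵇ_)
  open import Data.Nat.Properties using (_≤?_)
  open import Data.Nat.Coprimality using (1-coprimeTo) renaming (sym to coprime-sym)
  open import Data.Integer as ℤ using (+_)
  import Data.Integer.Properties as ℤP
  open import Data.Rational as ℚ using (ℚ; mkℚ; 0ℚ; 1ℚ; _/_; _+_; _-_; _*_; _⊔_; _⊓_) renaming (_≤_ to _≤ℚ_)
  import Data.Rational.Properties as ℚP
  open import Data.List using (List; []; _∷_; length; map; filter; tabulate)
  open import Data.List.Properties using (filter-all; length-filter; length-tabulate)
  open import Data.List.Relation.Unary.All as All using (All; []; _∷_)
  open import Data.List.Relation.Unary.All.Properties using (tabulate⁺)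
  open import Data.List.Relation.Unary.Linked as Linked using ()
  open import Data.List.Relation.Unary.Sorted.TotalOrder ℕ.≤-totalOrder using (Sorted)
  open import Data.List.Relation.Unary.Linked.Properties using (Linked⇒All)
  open import Data.List.Relation.Binary.Permutation.Propositional using (_↭_; ↭-sym)
  open import Data.List.Relation.Binary.Permutation.Propositional.Properties using (↭-length; filter-↭; All-resp-↭)
  open import Data.List.Sort.InsertionSort ℕ.≤-decTotalOrder using (sort)
  open import Data.List.Sort.InsertionSort.Properties ℕ.≤-decTotalOrder using (sort-↗; sort-↭)
  open import Algebra.Properties.Semiring.Sum (Ring.semiring ℚP.+-*-ring) as ℚ-Sum using () renaming (sum to sumℚ)
  open import Algebra.Solver.Ring.NaturalCoefficients.Default
    (CommutativeRing.commutativeSemiring ℚP.+-*-commutativeRing) using (solve; _:+_; _:*_; _:=_; con)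
  open import Relation.Binary.PropositionalEquality
  open ≡-Reasoning

  ℕ→ℚ≡mkℚ : ∀ n → ℕ→ℚ n ≡ mkℚ (+ n) 0 (coprime-sym (1-coprimeTo n))
  ℕ→ℚ≡mkℚ n = ℚP.normalize-coprime (coprime-sym (1-coprimeTo n))

  ℕ→ℚ-+ : ∀ m n → ℕ→ℚ (m ℕ.+ n) ≡ ℕ→ℚ m + ℕ→ℚ n
  ℕ→ℚ-+ m n rewrite ℕ→ℚ≡mkℚ m | ℕ→ℚ≡mkℚ n =
    cong (_/ 1) (trans (ℤP.pos-+ m n) (sym (cong₂ ℤ._+_ (ℤP.*-identityʳ (+ m)) (ℤP.*-identityʳ (+ n)))))

  ℕ→ℚ-mono-≤ : ∀ {m n} → m ℕ.≤ n → ℕ→ℚ m ≤ℚ ℕ→ℚ n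
  ℕ→ℚ-mono-≤ {m} {n} m≤n rewrite ℕ→ℚ≡mkℚ m | ℕ→ℚ≡mkℚ n =
    ℚ.*≤* (subst₂ ℤ._≤_ (sym (ℤP.*-identityʳ (+ m))) (sym (ℤP.*-identityʳ (+ n))) (ℤ.+≤+ m≤n))

  x+y-y≡x : ∀ x y → x + y - y ≡ x
  x+y-y≡x x y = trans (ℚP.+-assoc x y (ℚ.- y)) (trans (cong (λ z → x + z) (ℚP.+-inverseʳ y)) (ℚP.+-identityʳ x))

  x-y+y≡x : ∀ x y → x - y + y ≡ x
  x-y+y≡x x y = trans (ℚP.+-assoc x (ℚ.- y) y) (trans (cong (λ z → x + z) (ℚP.+-inverseˡ y)) (ℚP.+-identityʳ x))

  ℕ→ℚ-suc-1 : ∀ n → ℕ→ℚ (suc n) - 1ℚ ≡ ℕ→ℚ n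
  ℕ→ℚ-suc-1 n = trans (cong (_- 1ℚ) (trans (ℕ→ℚ-+ 1 n) (ℚP.+-comm 1ℚ (ℕ→ℚ n)))) (x+y-y≡x (ℕ→ℚ n) 1ℚ)

  x≤y⇒x-y≤0 : ∀ {x y} → x ≤ℚ y → x - y ≤ℚ 0ℚ
  x≤y⇒x-y≤0 {x} {y} x≤y = subst (x - y ≤ℚ_) (ℚP.+-inverseʳ y) (ℚP.+-monoˡ-≤ (ℚ.- y) x≤y)

  x≤y⇒0≤y-x : ∀ {x y} → x ≤ℚ y → 0ℚ ≤ℚ y - x
  x≤y⇒0≤y-x {x} {y} x≤y = subst (_≤ℚ y - x) (ℚP.+-inverseʳ x) (ℚP.+-monoˡ-≤ (ℚ.- x) x≤y)

  clamp01+⊔ : ∀ x → clamp01 x + (0ℚ ⊔ (x - 1ℚ)) ≡ 0ℚ ⊔ x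
  clamp01+⊔ x with ℚP.≤-total x 0ℚ | ℚP.≤-total x 1ℚ
  ... | inj₁ x≤0 | _ = begin
    0ℚ ⊔ (x ⊓ 1ℚ) + (0ℚ ⊔ (x - 1ℚ))
      ≡⟨ cong₂ _+_ (trans (cong (0ℚ ⊔_) (ℚP.p≤q⇒p⊓q≡p x≤1)) (ℚP.p≥q⇒p⊔q≡p x≤0)) (ℚP.p≥q⇒p⊔q≡p (x≤y⇒x-y≤0 x≤1)) ⟩
    0ℚ
      ≡⟨ sym (ℚP.p≥q⇒p⊔q≡p x≤0) ⟩
    0ℚ ⊔ x ∎
    where
    x≤1 : x ≤ℚ 1ℚ
    x≤1 = ℚP.≤-trans x≤0 (ℚ.*≤* (ℤ.+≤+ ℕ.z≤n))
  ... | inj₂ 0≤x | inj₁ x≤1 = begin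
    0ℚ ⊔ (x ⊓ 1ℚ) + (0ℚ ⊔ (x - 1ℚ))
      ≡⟨ cong₂ _+_ (trans (cong (0ℚ ⊔_) (ℚP.p≤q⇒p⊓q≡p x≤1)) (ℚP.p≤q⇒p⊔q≡q 0≤x)) (ℚP.p≥q⇒p⊔q≡p (x≤y⇒x-y≤0 x≤1)) ⟩
    x + 0ℚ
      ≡⟨ trans (ℚP.+-identityʳ x) (sym (ℚP.p≤q⇒p⊔q≡q 0≤x)) ⟩
    0ℚ ⊔ x ∎
  ... | inj₂ 0≤x | inj₂ 1≤x = begin
    0ℚ ⊔ (x ⊓ 1ℚ) + (0ℚ ⊔ (x - 1ℚ))
      ≡⟨ cong₂ _+_ (cong (0ℚ ⊔_) (ℚP.p≥q⇒p⊓q≡q 1≤x)) (ℚP.p≤q⇒p⊔q≡q (x≤y⇒0≤y-x 1≤x)) ⟩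
    1ℚ + (x - 1ℚ)
      ≡⟨ trans (ℚP.+-comm 1ℚ (x - 1ℚ)) (x-y+y≡x x 1ℚ) ⟩
    x
      ≡⟨ sym (ℚP.p≤q⇒p⊔q≡q 0≤x) ⟩
    0ℚ ⊔ x ∎

  count : ℕ → List ℕ → ℕ
  count i = length ∘ filter (i ≤?_)

  count-↭ : ∀ i {xs ys} → xs ↭ ys → count i xs ≡ count i ys
  count-↭ i xs↭ys = ↭-length (filter-↭ (i ≤?_) xs↭ys)

  count≤length : ∀ i xs → count i xs ℕ.≤ length xs
  count≤length i = length-filter (i ≤?_)

  atLeast : ℕ → ℕ → ℕ
  atLeast i a = if i ≤ᵇ a then 1 else 0

  ramp : ℕ → ℕ → ℚ → ℚ
  ramp len c x = 0ℚ ⊔ (x + ℕ→ℚ c - ℕ→ℚ len)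

  ramp-diagonal : ∀ {c len} x → c ≡ len → ramp len c x ≡ 0ℚ ⊔ x
  ramp-diagonal {len = len} x refl = cong (0ℚ ⊔_) (x+y-y≡x x (ℕ→ℚ len))

  ramp-pred : ∀ len c x → ramp len c (x - 1ℚ) ≡ ramp (suc len) c x
  ramp-pred len c x = cong (0ℚ ⊔_) (begin
    x - 1ℚ + ℕ→ℚ c - ℕ→ℚ len       ≡⟨ solve-shift ⟩
    x + ℕ→ℚ c - (1ℚ + ℕ→ℚ len)     ≡⟨ cong (λ z → x + ℕ→ℚ c - z) (sym (ℕ→ℚ-+ 1 len)) ⟩
    x + ℕ→ℚ c - ℕ→ℚ (suc len)      ∎)
    where
    solve-shift : x - 1ℚ + ℕ→ℚ c - ℕ→ℚ len ≡ x + ℕ→ℚ c - (1ℚ + ℕ→ℚ len)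
    solve-shift =
      trans (solve 4 (λ x m c l → x :+ m :+ c :+ l := x :+ c :+ (m :+ l)) refl x (ℚ.- 1ℚ) (ℕ→ℚ c) (ℚ.- ℕ→ℚ len))
            (cong (λ z → x + ℕ→ℚ c + z) (sym (ℚP.neg-distrib-+ 1ℚ (ℕ→ℚ len))))

  ramp-at-len : ∀ len c → ramp len c (ℕ→ℚ len) ≡ ℕ→ℚ c
  ramp-at-len len c = begin
    0ℚ ⊔ (ℕ→ℚ len + ℕ→ℚ c - ℕ→ℚ len) ≡⟨ cong (λ z → 0ℚ ⊔ (z - ℕ→ℚ len)) (ℚP.+-comm (ℕ→ℚ len) (ℕ→ℚ c)) ⟩
    0ℚ ⊔ (ℕ→ℚ c + ℕ→ℚ len - ℕ→ℚ len) ≡⟨ cong (0ℚ ⊔_) (x+y-y≡x (ℕ→ℚ c) (ℕ→ℚ len)) ⟩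
    0ℚ ⊔ ℕ→ℚ c                        ≡⟨ ℚP.p≤q⇒p⊔q≡q (ℕ→ℚ-mono-≤ {0} {c} ℕ.z≤n) ⟩
    ℕ→ℚ c                             ∎

  count-sorted : ∀ {i a L} → i ℕ.≤ a → Sorted (a ∷ L) → count i L ≡ length L
  count-sorted i≤a sorted = cong length (filter-all (_ ≤?_) (All.tail (Linked⇒All ℕ.≤-trans i≤a sorted)))

  -- The first unit segment has slope 1 exactly when a ≥ i.
  ramp-cons : ∀ i a L x → Sorted (a ∷ L) →
    ℕ→ℚ (atLeast i a) * clamp01 x + ramp (length L) (count i L) (x - 1ℚ) ≡ ramp (suc (length L)) (count i (a ∷ L)) x
  ramp-cons i a L x sorted with i ≤ᵇ a in i≤ᵇa
  ... | true = begin
    1ℚ * clamp01 x + ramp (length L) (count i L) (x - 1ℚ)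
      ≡⟨ cong₂ _+_ (ℚP.*-identityˡ (clamp01 x)) (ramp-diagonal (x - 1ℚ) (count-sorted i≤a sorted)) ⟩
    clamp01 x + (0ℚ ⊔ (x - 1ℚ))
      ≡⟨ clamp01+⊔ x ⟩
    0ℚ ⊔ x
      ≡⟨ sym (ramp-diagonal x (cong suc (count-sorted i≤a sorted))) ⟩
    ramp (suc (length L)) (suc (count i L)) x ∎
    where
    i≤a : i ℕ.≤ a
    i≤a = ℕ.≤ᵇ⇒≤ i a (subst T (sym i≤ᵇa) _)
  ... | false = trans (cong (_+ ramp (length L) (count i L) (x - 1ℚ)) (ℚP.*-zeroˡ (clamp01 x)))
                      (trans (ℚP.+-identityˡ _) (ramp-pred (length L) (count i L) x))

  module HodgeLevels (j : ℕ) .{{_ : ℕ.NonZero j}} (κ : ℚ)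
    (slope-levels : ∀ a → a ℕ.≤ j → + a / j ≡ κ * sumℚ (λ (i : Fin j) → ℕ→ℚ (atLeast (suc (toℕ i)) a))) where

    levels : List ℕ → ℚ → ℚ
    levels L x = κ * sumℚ (λ (i : Fin j) → ramp (length L) (count (suc (toℕ i)) L) x)

    fromSlopes-sorted : ∀ L → Sorted L → All (ℕ._≤ j) L → ∀ x → x ≤ℚ ℕ→ℚ (length L) →
      fromSlopes (map (λ a → + a / j) L) x ≡ levels L x
    fromSlopes-sorted [] _ _ x x≤0 = sym (begin
      κ * sumℚ {j} (λ _ → ramp 0 0 x) ≡⟨ cong (κ *_) (ℚ-Sum.sum-cong-≗ {j} (λ _ → ramp-0)) ⟩
      κ * sumℚ {j} (λ _ → 0ℚ)         ≡⟨ cong (κ *_) (ℚ-Sum.sum-replicate-zero j) ⟩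
      κ * 0ℚ                          ≡⟨ ℚP.*-zeroʳ κ ⟩
      0ℚ                              ∎)
      where
      ramp-0 : ramp 0 0 x ≡ 0ℚ
      ramp-0 = trans (cong (0ℚ ⊔_) (x+y-y≡x x 0ℚ)) (ℚP.p≥q⇒p⊔q≡p x≤0)
    fromSlopes-sorted (a ∷ L) sorted (a≤j ∷ L≤j) x x≤len = begin
      + a / j * clamp01 x + fromSlopes (map (λ a → + a / j) L) (x - 1ℚ)
        ≡⟨ cong₂ (λ s r → s * clamp01 x + r) (slope-levels a a≤j)
                 (fromSlopes-sorted L (Linked.tail sorted) L≤j (x - 1ℚ) x-1≤len) ⟩
      κ * sumℚ ind * clamp01 x + κ * sumℚ ramps
        ≡⟨ cong (_+ κ * sumℚ ramps) (ℚP.*-assoc κ (sumℚ ind) (clamp01 x)) ⟩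
      κ * (sumℚ ind * clamp01 x) + κ * sumℚ ramps
        ≡⟨ sym (ℚP.*-distribˡ-+ κ _ _) ⟩
      κ * (sumℚ ind * clamp01 x + sumℚ ramps)
        ≡⟨ cong (λ s → κ * (s + sumℚ ramps)) (ℚ-Sum.*-distribʳ-sum (clamp01 x) ind) ⟩
      κ * (sumℚ (λ i → ind i * clamp01 x) + sumℚ ramps)
        ≡⟨ cong (κ *_) (sym (ℚ-Sum.∑-distrib-+ (λ i → ind i * clamp01 x) ramps)) ⟩
      κ * sumℚ (λ i → ind i * clamp01 x + ramps i)
        ≡⟨ cong (κ *_) (ℚ-Sum.sum-cong-≗ {j} (λ i → ramp-cons (suc (toℕ i)) a L x sorted)) ⟩
      levels (a ∷ L) x ∎
      where
      ind : Fin j → ℚ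
      ind i = ℕ→ℚ (atLeast (suc (toℕ i)) a)
      ramps : Fin j → ℚ
      ramps i = ramp (length L) (count (suc (toℕ i)) L) (x - 1ℚ)
      x-1≤len : x - 1ℚ ≤ℚ ℕ→ℚ (length L)
      x-1≤len = subst (x - 1ℚ ≤ℚ_) (ℕ→ℚ-suc-1 (length L)) (ℚP.+-monoˡ-≤ (ℚ.- 1ℚ) x≤len)

    Hdg-levels : ∀ h (a : Fin h → ℕ) → (∀ l → a l ℕ.≤ j) → ∀ x → x ≤ℚ ℕ→ℚ h →
      Hdg j h a x ≡ κ * sumℚ (λ (i : Fin j) → ramp h (count (suc (toℕ i)) (tabulate a)) x)
    Hdg-levels h a a≤j x x≤h = begin
      Hdg j h a x
        ≡⟨ fromSlopes-sorted (sort (tabulate a)) (sort-↗ (tabulate a))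
             (All-resp-↭ (↭-sym (sort-↭ (tabulate a))) (tabulate⁺ a≤j))
             x (subst (λ n → x ≤ℚ ℕ→ℚ n) (sym length-sort) x≤h) ⟩
      levels (sort (tabulate a)) x
        ≡⟨ cong (κ *_) (ℚ-Sum.sum-cong-≗ {j} (λ i →
             cong₂ (λ len c → ramp len c x) length-sort (count-↭ (suc (toℕ i)) (sort-↭ (tabulate a))))) ⟩
      κ * sumℚ (λ (i : Fin j) → ramp h (count (suc (toℕ i)) (tabulate a)) x) ∎
      where
      length-sort : length (sort (tabulate a)) ≡ h
      length-sort = trans (↭-length (sort-↭ (tabulate a))) (length-tabulate a)

  levelCounts : ∀ {h} (j : ℕ) → (Fin h → ℕ) → Fin j → ℕ
  levelCounts j a i = count (suc (toℕ i)) (tabulate a)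

  Hdg₃≡P : ∀ h (a : Fin h → ℕ) → (∀ l → a l ℕ.≤ 3) →
           ∀ x → x ≤ℚ ℕ→ℚ h → Hdg 3 h a x ≡ P h (tabulate (levelCounts 3 a)) x
  Hdg₃≡P = HodgeLevels.Hdg-levels 3 (+ 1 / 3) slopes
    where
    slopes : ∀ a → a ℕ.≤ 3 → + a / 3 ≡ (+ 1 / 3) * sumℚ (λ (i : Fin 3) → ℕ→ℚ (atLeast (suc (toℕ i)) a))
    slopes 0 _ = refl
    slopes 1 _ = refl
    slopes 2 _ = refl
    slopes 3 _ = refl
    slopes (suc (suc (suc (suc _)))) (ℕ.s≤s (ℕ.s≤s (ℕ.s≤s ())))

  Hdg₂≡P : ∀ h (a : Fin h → ℕ) → (∀ l → a l ℕ.≤ 2) →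
           ∀ x → x ≤ℚ ℕ→ℚ h → Hdg 2 h a x ≡ P h (tabulate (levelCounts 2 a)) x
  Hdg₂≡P = HodgeLevels.Hdg-levels 2 (+ 1 / 2) slopes
    where
    slopes : ∀ a → a ℕ.≤ 2 → + a / 2 ≡ (+ 1 / 2) * sumℚ (λ (i : Fin 2) → ℕ→ℚ (atLeast (suc (toℕ i)) a))
    slopes 0 _ = refl
    slopes 1 _ = refl
    slopes 2 _ = refl
    slopes (suc (suc (suc _))) (ℕ.s≤s (ℕ.s≤s ()))

  P-at-h₃ : ∀ h c₁ c₂ c₃ → P h (c₁ ∷ c₂ ∷ c₃ ∷ []) (ℕ→ℚ h) ≡ + (c₁ ℕ.+ (c₂ ℕ.+ c₃)) / 3
  P-at-h₃ h c₁ c₂ c₃ = begin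
    (+ 1 / 3) * (ramp h c₁ (ℕ→ℚ h) + (ramp h c₂ (ℕ→ℚ h) + (ramp h c₃ (ℕ→ℚ h) + 0ℚ)))
      ≡⟨ cong (λ s → (+ 1 / 3) * s) (cong₂ _+_ (ramp-at-len h c₁) (cong₂ _+_ (ramp-at-len h c₂)
           (trans (cong (_+ 0ℚ) (ramp-at-len h c₃)) (ℚP.+-identityʳ _)))) ⟩
    (+ 1 / 3) * (ℕ→ℚ c₁ + (ℕ→ℚ c₂ + ℕ→ℚ c₃))
      ≡⟨ cong (λ s → (+ 1 / 3) * s) (sym (trans (ℕ→ℚ-+ c₁ (c₂ ℕ.+ c₃)) (cong (λ s → ℕ→ℚ c₁ + s) (ℕ→ℚ-+ c₂ c₃)))) ⟩
    (+ 1 / 3) * ℕ→ℚ (c₁ ℕ.+ (c₂ ℕ.+ c₃))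
      ≡⟨ cong ((+ 1 / 3) *_) (ℕ→ℚ≡mkℚ (c₁ ℕ.+ (c₂ ℕ.+ c₃))) ⟩
    (+ 1 / 3) * mkℚ (+ (c₁ ℕ.+ (c₂ ℕ.+ c₃))) 0 (coprime-sym (1-coprimeTo _))
      ≡⟨ cong (_/ 3) (ℤP.*-identityˡ (+ (c₁ ℕ.+ (c₂ ℕ.+ c₃)))) ⟩
    + (c₁ ℕ.+ (c₂ ℕ.+ c₃)) / 3 ∎

  P-at-h₂ : ∀ h c₁ c₂ → P h (c₁ ∷ c₂ ∷ []) (ℕ→ℚ h) ≡ + (c₁ ℕ.+ c₂) / 2
  P-at-h₂ h c₁ c₂ = begin
    (+ 1 / 2) * (ramp h c₁ (ℕ→ℚ h) + (ramp h c₂ (ℕ→ℚ h) + 0ℚ))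
      ≡⟨ cong (λ s → (+ 1 / 2) * s)
              (cong₂ _+_ (ramp-at-len h c₁) (trans (cong (_+ 0ℚ) (ramp-at-len h c₂)) (ℚP.+-identityʳ _))) ⟩
    (+ 1 / 2) * (ℕ→ℚ c₁ + ℕ→ℚ c₂)
      ≡⟨ cong (λ s → (+ 1 / 2) * s) (sym (ℕ→ℚ-+ c₁ c₂)) ⟩
    (+ 1 / 2) * ℕ→ℚ (c₁ ℕ.+ c₂)
      ≡⟨ cong ((+ 1 / 2) *_) (ℕ→ℚ≡mkℚ (c₁ ℕ.+ c₂)) ⟩
    (+ 1 / 2) * mkℚ (+ (c₁ ℕ.+ c₂)) 0 (coprime-sym (1-coprimeTo _))
      ≡⟨ cong (_/ 2) (ℤP.*-identityˡ (+ (c₁ ℕ.+ c₂))) ⟩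
    + (c₁ ℕ.+ c₂) / 2 ∎

  star-P : ∀ h c₁ c₂ c₃ x → star 2 1 (P h (c₁ ∷ c₂ ∷ [])) (P h (c₃ ∷ [])) x ≡ P h (c₁ ∷ c₂ ∷ c₃ ∷ []) x
  star-P h c₁ c₂ c₃ x = begin
    (ℕ→ℚ 2 * ((+ 1 / 2) * (r₁ + (r₂ + 0ℚ))) + ℕ→ℚ 1 * ((+ 1 / 1) * (r₃ + 0ℚ))) * (+ 1 / 3)
      ≡⟨ solve 8 (λ two half one one′ third u v w →
                    (two :* (half :* (u :+ (v :+ con 0))) :+ one :* (one′ :* (w :+ con 0))) :* third
                 := third :* ((two :* half) :* (u :+ v) :+ (one :* one′) :* w)) refl
               (ℕ→ℚ 2) (+ 1 / 2) (ℕ→ℚ 1) (+ 1 / 1) (+ 1 / 3) r₁ r₂ r₃ ⟩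
    (+ 1 / 3) * (1ℚ * (r₁ + r₂) + 1ℚ * r₃)
      ≡⟨ cong ((+ 1 / 3) *_) (cong₂ _+_ (ℚP.*-identityˡ (r₁ + r₂)) (ℚP.*-identityˡ r₃)) ⟩
    (+ 1 / 3) * ((r₁ + r₂) + r₃)
      ≡⟨ cong ((+ 1 / 3) *_) (trans (ℚP.+-assoc r₁ r₂ r₃) (cong (λ s → r₁ + (r₂ + s)) (sym (ℚP.+-identityʳ r₃)))) ⟩
    (+ 1 / 3) * (r₁ + (r₂ + (r₃ + 0ℚ))) ∎
    where
    r₁ r₂ r₃ : ℚ
    r₁ = ramp h c₁ x
    r₂ = ramp h c₂ x
    r₃ = ramp h c₃ x

  -- (0 ⊔ a) + (0 ⊔ b) is the largest of the subset sums 0, a, b, a + b.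
  ⊔0+⊔0≤ : ∀ {a b z} → 0ℚ ≤ℚ z → a ≤ℚ z → b ≤ℚ z → a + b ≤ℚ z → (0ℚ ⊔ a) + (0ℚ ⊔ b) ≤ℚ z
  ⊔0+⊔0≤ {a} {b} 0≤z a≤z b≤z a+b≤z with ℚP.≤-total a 0ℚ | ℚP.≤-total b 0ℚ
  ... | inj₁ a≤0 | inj₁ b≤0 rewrite ℚP.p≥q⇒p⊔q≡p a≤0 | ℚP.p≥q⇒p⊔q≡p b≤0 = 0≤z
  ... | inj₁ a≤0 | inj₂ 0≤b rewrite ℚP.p≥q⇒p⊔q≡p a≤0 | ℚP.p≤q⇒p⊔q≡q 0≤b | ℚP.+-identityˡ b = b≤z
  ... | inj₂ 0≤a | inj₁ b≤0 rewrite ℚP.p≤q⇒p⊔q≡q 0≤a | ℚP.p≥q⇒p⊔q≡p b≤0 | ℚP.+-identityʳ a = a≤z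
  ... | inj₂ 0≤a | inj₂ 0≤b rewrite ℚP.p≤q⇒p⊔q≡q 0≤a | ℚP.p≤q⇒p⊔q≡q 0≤b = a+b≤z

  ⊔0+⊔0+⊔0≤ : ∀ {a b c z} → 0ℚ ≤ℚ z → a ≤ℚ z → b ≤ℚ z → c ≤ℚ z →
              a + b ≤ℚ z → a + c ≤ℚ z → b + c ≤ℚ z → a + (b + c) ≤ℚ z →
              (0ℚ ⊔ a) + ((0ℚ ⊔ b) + (0ℚ ⊔ c)) ≤ℚ z
  ⊔0+⊔0+⊔0≤ {a} {b} {c} {z} 0≤z a≤z b≤z c≤z a+b≤z a+c≤z b+c≤z a+b+c≤z with ℚP.≤-total a 0ℚ
  ... | inj₁ a≤0 rewrite ℚP.p≥q⇒p⊔q≡p a≤0 | ℚP.+-identityˡ ((0ℚ ⊔ b) + (0ℚ ⊔ c)) = ⊔0+⊔0≤ 0≤z b≤z c≤z b+c≤z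
  ... | inj₂ 0≤a rewrite ℚP.p≤q⇒p⊔q≡q 0≤a =
    subst₂ _≤ℚ_ (ℚP.+-comm _ a) (x-y+y≡x z a)
      (ℚP.+-monoˡ-≤ a (⊔0+⊔0≤ (x≤y⇒0≤y-x a≤z) (minus-a a+b≤z) (minus-a a+c≤z) (minus-a a+b+c≤z)))
    where
    minus-a : ∀ {y} → a + y ≤ℚ z → y ≤ℚ z - a
    minus-a {y} a+y≤z =
      subst (_≤ℚ z - a) (trans (cong (_- a) (ℚP.+-comm a y)) (x+y-y≡x y a)) (ℚP.+-monoˡ-≤ (ℚ.- a) a+y≤z)

  record Submajorized₂ (g₁ g₂ c₁ c₂ : ℕ) : Set where
    field
      g₁≤c₁   : g₁ ℕ.≤ c₁
      g₂≤c₁   : g₂ ℕ.≤ c₁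
      g₁₂≤c₁₂ : g₁ ℕ.+ g₂ ℕ.≤ c₁ ℕ.+ c₂

  record Submajorized₃ (g₁ g₂ g₃ c₁ c₂ c₃ : ℕ) : Set where
    field
      g₁≤c₁    : g₁ ℕ.≤ c₁
      g₂≤c₁    : g₂ ℕ.≤ c₁
      g₃≤c₁    : g₃ ℕ.≤ c₁
      g₁₂≤c₁₂  : g₁ ℕ.+ g₂ ℕ.≤ c₁ ℕ.+ c₂
      g₁₃≤c₁₂  : g₁ ℕ.+ g₃ ℕ.≤ c₁ ℕ.+ c₂
      g₂₃≤c₁₂  : g₂ ℕ.+ g₃ ℕ.≤ c₁ ℕ.+ c₂
      g₁₂₃≤c₁₂₃ : g₁ ℕ.+ (g₂ ℕ.+ g₃) ℕ.≤ c₁ ℕ.+ (c₂ ℕ.+ c₃)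

  module _ (h : ℕ) (x : ℚ) where
    private
      w : ℚ
      w = x - ℕ→ℚ h

      v : ℕ → ℚ
      v c = x + ℕ→ℚ c - ℕ→ℚ h

      v≡w+ : ∀ c → v c ≡ w + ℕ→ℚ c
      v≡w+ c = solve 3 (λ x c m → x :+ c :+ m := x :+ m :+ c) refl x (ℕ→ℚ c) (ℚ.- ℕ→ℚ h)

      v₂≡w₂+ : ∀ c d → v c + v d ≡ (w + w) + ℕ→ℚ (c ℕ.+ d)
      v₂≡w₂+ c d = trans (cong₂ _+_ (v≡w+ c) (v≡w+ d))
        (trans (solve 3 (λ w c d → (w :+ c) :+ (w :+ d) := (w :+ w) :+ (c :+ d)) refl w (ℕ→ℚ c) (ℕ→ℚ d))
               (cong (λ s → (w + w) + s) (sym (ℕ→ℚ-+ c d))))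

      v₃≡w₃+ : ∀ c d e → v c + (v d + v e) ≡ (w + (w + w)) + ℕ→ℚ (c ℕ.+ (d ℕ.+ e))
      v₃≡w₃+ c d e = trans (cong₂ _+_ (v≡w+ c) (v₂≡w₂+ d e))
        (trans (solve 3 (λ w c s → (w :+ c) :+ ((w :+ w) :+ s) := (w :+ (w :+ w)) :+ (c :+ s))
                        refl w (ℕ→ℚ c) (ℕ→ℚ (d ℕ.+ e)))
               (cong (λ s → (w + (w + w)) + s) (sym (ℕ→ℚ-+ c (d ℕ.+ e)))))

      v-mono₁ : ∀ {c d} → c ℕ.≤ d → v c ≤ℚ v d
      v-mono₁ {c} {d} c≤d = subst₂ _≤ℚ_ (sym (v≡w+ c)) (sym (v≡w+ d)) (ℚP.+-monoʳ-≤ w (ℕ→ℚ-mono-≤ c≤d))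

      v-mono₂ : ∀ c d c′ d′ → c ℕ.+ d ℕ.≤ c′ ℕ.+ d′ → v c + v d ≤ℚ v c′ + v d′
      v-mono₂ c d c′ d′ sum≤ =
        subst₂ _≤ℚ_ (sym (v₂≡w₂+ c d)) (sym (v₂≡w₂+ c′ d′)) (ℚP.+-monoʳ-≤ (w + w) (ℕ→ℚ-mono-≤ sum≤))

      v-mono₃ : ∀ c d e c′ d′ e′ → c ℕ.+ (d ℕ.+ e) ℕ.≤ c′ ℕ.+ (d′ ℕ.+ e′) →
                v c + (v d + v e) ≤ℚ v c′ + (v d′ + v e′)
      v-mono₃ c d e c′ d′ e′ sum≤ =
        subst₂ _≤ℚ_ (sym (v₃≡w₃+ c d e)) (sym (v₃≡w₃+ c′ d′ e′)) (ℚP.+-monoʳ-≤ (w + (w + w)) (ℕ→ℚ-mono-≤ sum≤))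

      0≤ramp : ∀ c → 0ℚ ≤ℚ ramp h c x
      0≤ramp c = ℚP.p≤p⊔q 0ℚ (v c)

      v≤ramp : ∀ c → v c ≤ℚ ramp h c x
      v≤ramp c = ℚP.p≤q⊔p 0ℚ (v c)

    P-mono₂ : ∀ {g₁ g₂ c₁ c₂} → Submajorized₂ g₁ g₂ c₁ c₂ →
              P h (g₁ ∷ g₂ ∷ []) x ≤ℚ P h (c₁ ∷ c₂ ∷ []) x
    P-mono₂ {g₁} {g₂} {c₁} {c₂} g≺c = ℚP.*-monoˡ-≤-nonNeg (+ 1 / 2)
      (subst₂ _≤ℚ_ (cong (λ s → ramp h g₁ x + s) (sym (ℚP.+-identityʳ (ramp h g₂ x))))
                   (cong (λ s → ramp h c₁ x + s) (sym (ℚP.+-identityʳ (ramp h c₂ x))))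
        (⊔0+⊔0≤ (ℚP.+-mono-≤ (0≤ramp c₁) (0≤ramp c₂)) (bound₁ g₁≤c₁) (bound₁ g₂≤c₁)
          (ℚP.≤-trans (v-mono₂ g₁ g₂ c₁ c₂ g₁₂≤c₁₂) (ℚP.+-mono-≤ (v≤ramp c₁) (v≤ramp c₂)))))
      where
      open Submajorized₂ g≺c
      bound₁ : ∀ {g} → g ℕ.≤ c₁ → v g ≤ℚ ramp h c₁ x + ramp h c₂ x
      bound₁ g≤c₁ = ℚP.≤-trans (v-mono₁ g≤c₁)
        (subst (_≤ℚ ramp h c₁ x + ramp h c₂ x) (ℚP.+-identityʳ (v c₁)) (ℚP.+-mono-≤ (v≤ramp c₁) (0≤ramp c₂)))

    P-mono₃ : ∀ {g₁ g₂ g₃ c₁ c₂ c₃} → Submajorized₃ g₁ g₂ g₃ c₁ c₂ c₃ →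
              P h (g₁ ∷ g₂ ∷ g₃ ∷ []) x ≤ℚ P h (c₁ ∷ c₂ ∷ c₃ ∷ []) x
    P-mono₃ {g₁} {g₂} {g₃} {c₁} {c₂} {c₃} g≺c = ℚP.*-monoˡ-≤-nonNeg (+ 1 / 3)
      (subst₂ _≤ℚ_ (cong (λ s → ramp h g₁ x + (ramp h g₂ x + s)) (sym (ℚP.+-identityʳ (ramp h g₃ x))))
                   (cong (λ s → ramp h c₁ x + (ramp h c₂ x + s)) (sym (ℚP.+-identityʳ (ramp h c₃ x))))
        (⊔0+⊔0+⊔0≤ (ℚP.+-mono-≤ (0≤ramp c₁) (ℚP.+-mono-≤ (0≤ramp c₂) (0≤ramp c₃)))
          (bound₁ g₁≤c₁) (bound₁ g₂≤c₁) (bound₁ g₃≤c₁)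
          (bound₂ g₁ g₂ g₁₂≤c₁₂) (bound₂ g₁ g₃ g₁₃≤c₁₂) (bound₂ g₂ g₃ g₂₃≤c₁₂)
          (ℚP.≤-trans (v-mono₃ g₁ g₂ g₃ c₁ c₂ c₃ g₁₂₃≤c₁₂₃)
                      (ℚP.+-mono-≤ (v≤ramp c₁) (ℚP.+-mono-≤ (v≤ramp c₂) (v≤ramp c₃))))))
      where
      open Submajorized₃ g≺c
      Z : ℚ
      Z = ramp h c₁ x + (ramp h c₂ x + ramp h c₃ x)
      bound₁ : ∀ {g} → g ℕ.≤ c₁ → v g ≤ℚ Z
      bound₁ g≤c₁ = ℚP.≤-trans (v-mono₁ g≤c₁)
        (subst (_≤ℚ Z) (trans (cong (λ s → v c₁ + s) (ℚP.+-identityʳ 0ℚ)) (ℚP.+-identityʳ (v c₁)))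
               (ℚP.+-mono-≤ (v≤ramp c₁) (ℚP.+-mono-≤ (0≤ramp c₂) (0≤ramp c₃))))
      bound₂ : ∀ g g′ → g ℕ.+ g′ ℕ.≤ c₁ ℕ.+ c₂ → v g + v g′ ≤ℚ Z
      bound₂ g g′ ≤c₁₂ = ℚP.≤-trans (v-mono₂ g g′ c₁ c₂ ≤c₁₂)
        (subst (_≤ℚ Z) (cong (λ s → v c₁ + s) (ℚP.+-identityʳ (v c₂)))
               (ℚP.+-mono-≤ (v≤ramp c₁) (ℚP.+-mono-≤ (v≤ramp c₂) (0≤ramp c₃))))

  star-Hdg₂ : ∀ h (b : Fin h → ℕ) → (∀ l → b l ℕ.≤ 2) → ∀ c x → x ≤ℚ ℕ→ℚ h →
    star 2 1 (Hdg 2 h b) (P h (c ∷ [])) x ≡ P h (levelCounts 2 b 0F ∷ levelCounts 2 b 1F ∷ c ∷ []) x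
  star-Hdg₂ h b b≤2 c x x≤h =
    trans (cong (λ y → (ℕ→ℚ 2 * y + ℕ→ℚ 1 * P h (c ∷ []) x) * (+ 1 / 3)) (Hdg₂≡P h b b≤2 x x≤h))
          (star-P h (levelCounts 2 b 0F) (levelCounts 2 b 1F) c x)

  levelCount≤h : ∀ {h} j (a : Fin h → ℕ) i → levelCounts j a i ℕ.≤ h
  levelCount≤h j a i = subst (levelCounts j a i ℕ.≤_) (length-tabulate a) (count≤length _ (tabulate a))

  Hdg₃∈𝒫₃ : ∀ h (a : Fin h → ℕ) → (∀ l → a l ℕ.≤ 3) → In𝒫 3 h (Hdg 3 h a)
  Hdg₃∈𝒫₃ h a a≤3 = levelCounts 3 a , levelCount≤h 3 a , λ x x∈ → Hdg₃≡P h a a≤3 x (proj₂ x∈)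

  Hdg₂∈𝒫₂ : ∀ h (b : Fin h → ℕ) → (∀ l → b l ℕ.≤ 2) → In𝒫 2 h (Hdg 2 h b)
  Hdg₂∈𝒫₂ h b b≤2 = levelCounts 2 b , levelCount≤h 2 b , λ x x∈ → Hdg₂≡P h b b≤2 x (proj₂ x∈)

  Hdg₃-at-h : ∀ h (a : Fin h → ℕ) → (∀ l → a l ℕ.≤ 3) →
    Hdg 3 h a (ℕ→ℚ h) ≡ + (levelCounts 3 a 0F ℕ.+ (levelCounts 3 a 1F ℕ.+ levelCounts 3 a 2F)) / 3
  Hdg₃-at-h h a a≤3 = trans (Hdg₃≡P h a a≤3 (ℕ→ℚ h) ℚP.≤-refl)
                            (P-at-h₃ h (levelCounts 3 a 0F) (levelCounts 3 a 1F) (levelCounts 3 a 2F))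

  Hdg₂-at-h : ∀ h (b : Fin h → ℕ) → (∀ l → b l ℕ.≤ 2) →
    Hdg 2 h b (ℕ→ℚ h) ≡ + (levelCounts 2 b 0F ℕ.+ levelCounts 2 b 1F) / 2
  Hdg₂-at-h h b b≤2 = trans (Hdg₂≡P h b b≤2 (ℕ→ℚ h) ℚP.≤-refl) (P-at-h₂ h (levelCounts 2 b 0F) (levelCounts 2 b 1F))

  Hdg₃≥star : ∀ h (a b : Fin h → ℕ) c → (∀ l → a l ℕ.≤ 3) → (∀ l → b l ℕ.≤ 2) →
    let α = levelCounts 3 a ; β = levelCounts 2 b in
    Submajorized₃ (β 0F) (β 1F) c (α 0F) (α 1F) (α 2F) → Hdg 3 h a ≥[ h ] star 2 1 (Hdg 2 h b) (P h (c ∷ []))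
  Hdg₃≥star h a b c a≤3 b≤2 βc≺α x (_ , x≤h) =
    subst₂ _≤ℚ_ (sym (star-Hdg₂ h b b≤2 c x x≤h)) (sym (Hdg₃≡P h a a≤3 x x≤h)) (P-mono₃ h x βc≺α)

  Hdg₂≥P : ∀ h (b : Fin h → ℕ) c₁ c₂ → (∀ l → b l ℕ.≤ 2) →
    Submajorized₂ c₁ c₂ (levelCounts 2 b 0F) (levelCounts 2 b 1F) → Hdg 2 h b ≥[ h ] P h (c₁ ∷ c₂ ∷ [])
  Hdg₂≥P h b c₁ c₂ b≤2 c≺β x (_ , x≤h) =
    subst (P h (c₁ ∷ c₂ ∷ []) x ≤ℚ_) (sym (Hdg₂≡P h b b≤2 x x≤h)) (P-mono₂ h x c≺β)

module LevelInequalities where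
  open Polygons
  open import Data.Nat using (_+_; _≤ᵇ_)
  open import Data.List using (tabulate)
  open import Data.Integer using (+_)
  open import Data.Rational using (_/_)
  open import Relation.Binary.PropositionalEquality

  count-tabulate : ∀ i {h} (a : Fin h → ℕ) → count i (tabulate a) ≡ sumℕ (λ l → atLeast i (a l))
  count-tabulate i {zero}  a = refl
  count-tabulate i {suc h} a with i ≤ᵇ a zero
  ... | true  = cong suc (count-tabulate i (a ∘ suc))
  ... | false = count-tabulate i (a ∘ suc)

  level-sums₃ : ∀ {h} (a : Fin h → ℕ) → (∀ l → a l ≤ 3) →
    (levelCounts 3 a 0F + (levelCounts 3 a 1F + levelCounts 3 a 2F) ≡ sumℕ a) ×
    (levelCounts 3 a 1F + levelCounts 3 a 2F ≡ sumℕ (λ l → a l ∸ 1)) ×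
    (levelCounts 3 a 2F ≡ sumℕ (λ l → a l ∸ 2))
  level-sums₃ a a≤3
    rewrite count-tabulate 1 a | count-tabulate 2 a | count-tabulate 3 a =
      trans (cong (λ s → sumℕ (λ l → atLeast 1 (a l)) + s) (sym (ℕ-Sum.∑-distrib-+ (atLeast 2 ∘ a) (atLeast 3 ∘ a))))
        (trans (sym (ℕ-Sum.∑-distrib-+ (atLeast 1 ∘ a) (λ l → atLeast 2 (a l) + atLeast 3 (a l))))
               (ℕ-Sum.sum-cong-≗ (proj₁ ∘ by-cases))) ,
      trans (sym (ℕ-Sum.∑-distrib-+ (atLeast 2 ∘ a) (atLeast 3 ∘ a))) (ℕ-Sum.sum-cong-≗ (proj₁ ∘ proj₂ ∘ by-cases)) ,
      ℕ-Sum.sum-cong-≗ (proj₂ ∘ proj₂ ∘ by-cases)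
    where
    by-cases : ∀ l → (atLeast 1 (a l) + (atLeast 2 (a l) + atLeast 3 (a l)) ≡ a l)
                   × (atLeast 2 (a l) + atLeast 3 (a l) ≡ a l ∸ 1) × (atLeast 3 (a l) ≡ a l ∸ 2)
    by-cases l with a l | a≤3 l
    ... | 0 | _ = refl , refl , refl
    ... | 1 | _ = refl , refl , refl
    ... | 2 | _ = refl , refl , refl
    ... | 3 | _ = refl , refl , refl
    ... | suc (suc (suc (suc _))) | ℕ.s≤s (ℕ.s≤s (ℕ.s≤s ()))

  level-sums₂ : ∀ {h} (a : Fin h → ℕ) → (∀ l → a l ≤ 2) →
    (levelCounts 2 a 0F + levelCounts 2 a 1F ≡ sumℕ a) × (levelCounts 2 a 1F ≡ sumℕ (λ l → a l ∸ 1))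
  level-sums₂ a a≤2
    rewrite count-tabulate 1 a | count-tabulate 2 a =
      trans (sym (ℕ-Sum.∑-distrib-+ (atLeast 1 ∘ a) (atLeast 2 ∘ a))) (ℕ-Sum.sum-cong-≗ (proj₁ ∘ by-cases)) ,
      ℕ-Sum.sum-cong-≗ (proj₂ ∘ by-cases)
    where
    by-cases : ∀ l → (atLeast 1 (a l) + atLeast 2 (a l) ≡ a l) × (atLeast 2 (a l) ≡ a l ∸ 1)
    by-cases l with a l | a≤2 l
    ... | 0 | _ = refl , refl
    ... | 1 | _ = refl , refl
    ... | 2 | _ = refl , refl
    ... | suc (suc (suc _)) | ℕ.s≤s (ℕ.s≤s ())

  submajorized₂ : ∀ {c₁ c₂ g₁ g₂} → c₂ ≤ c₁ → g₁ + g₂ ≡ c₁ + c₂ → g₂ ≤ c₂ → Submajorized₂ c₁ c₂ g₁ g₂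
  submajorized₂ {c₁} {c₂} {g₁} {g₂} c₂≤c₁ g-total g₂≤c₂ = record
    { g₁≤c₁   = c₁≤g₁
    ; g₂≤c₁   = ℕ.≤-trans c₂≤c₁ c₁≤g₁
    ; g₁₂≤c₁₂ = ℕ.≤-reflexive (sym g-total)
    }
    where
    c₁≤g₁ : c₁ ≤ g₁
    c₁≤g₁ = ℕ.+-cancelʳ-≤ c₂ c₁ g₁ (subst (_≤ g₁ + c₂) g-total (ℕ.+-monoʳ-≤ g₁ g₂≤c₂))

  -- For a family with the same total as c, it suffices to control the sums not involving g₁.
  submajorized₃ : ∀ {g₁ g₂ g₃ c₁ c₂ c₃} → g₁ + (g₂ + g₃) ≡ c₁ + (c₂ + c₃) →
    c₂ + c₃ ≤ g₂ + g₃ → c₃ ≤ g₂ → c₃ ≤ g₃ → g₂ ≤ c₁ → g₃ ≤ c₁ → g₂ + g₃ ≤ c₁ + c₂ →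
    Submajorized₃ g₁ g₂ g₃ c₁ c₂ c₃
  submajorized₃ {g₁} {g₂} {g₃} {c₁} {c₂} {c₃} total c₂₃≤g₂₃ c₃≤g₂ c₃≤g₃ g₂≤c₁ g₃≤c₁ g₂₃≤c₁₂ = record
    { g₁≤c₁     = ℕ.+-cancelʳ-≤ (g₂ + g₃) g₁ c₁ (subst (_≤ c₁ + (g₂ + g₃)) (sym total) (ℕ.+-monoʳ-≤ c₁ c₂₃≤g₂₃))
    ; g₂≤c₁     = g₂≤c₁
    ; g₃≤c₁     = g₃≤c₁
    ; g₁₂≤c₁₂   = ℕ.+-cancelʳ-≤ g₃ (g₁ + g₂) (c₁ + c₂) (leave-out g₃ (g₁ + g₂) (ℕ.+-assoc g₁ g₂ g₃) c₃≤g₃)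
    ; g₁₃≤c₁₂   = ℕ.+-cancelʳ-≤ g₂ (g₁ + g₃) (c₁ + c₂) (leave-out g₂ (g₁ + g₃) g₁₃₂≡g₁₂₃ c₃≤g₂)
    ; g₂₃≤c₁₂   = g₂₃≤c₁₂
    ; g₁₂₃≤c₁₂₃ = ℕ.≤-reflexive total
    }
    where
    leave-out : ∀ g s → s + g ≡ g₁ + (g₂ + g₃) → c₃ ≤ g → s + g ≤ c₁ + c₂ + g
    leave-out g s ≡total c₃≤g = begin
      s + g               ≡⟨ trans ≡total total ⟩
      c₁ + (c₂ + c₃)      ≡⟨ sym (ℕ.+-assoc c₁ c₂ c₃) ⟩
      c₁ + c₂ + c₃        ≤⟨ ℕ.+-monoʳ-≤ (c₁ + c₂) c₃≤g ⟩
      c₁ + c₂ + g         ∎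
      where open ℕ.≤-Reasoning
    g₁₃₂≡g₁₂₃ : g₁ + g₃ + g₂ ≡ g₁ + (g₂ + g₃)
    g₁₃₂≡g₁₂₃ = trans (ℕ.+-assoc g₁ g₃ g₂) (cong (λ s → g₁ + s) (ℕ.+-comm g₃ g₂))

  module FromRanks {h d₁ d₂ d₃ : ℕ} {a b e : Fin h → ℕ} (d₂≤d₁ : d₂ ≤ d₁) (d₃≤d₂ : d₃ ≤ d₂)
    (a≤3 : ∀ l → a l ≤ 3) (b≤2 : ∀ l → b l ≤ 2) (e≤2 : ∀ l → e l ≤ 2)
    (ranks : RankInequalities h d₁ d₂ d₃ a b e) where
    open RankInequalities ranks
    open ℕ.≤-Reasoning

    α : Fin 3 → ℕ
    α = levelCounts 3 a

    β ε : Fin 2 → ℕ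
    β = levelCounts 2 b
    ε = levelCounts 2 e

    sum-a : α 0F + (α 1F + α 2F) ≡ sumℕ a
    sum-a = proj₁ (level-sums₃ a a≤3)

    sum-a∸1 : α 1F + α 2F ≡ sumℕ (λ l → a l ∸ 1)
    sum-a∸1 = proj₁ (proj₂ (level-sums₃ a a≤3))

    sum-a∸2 : α 2F ≡ sumℕ (λ l → a l ∸ 2)
    sum-a∸2 = proj₂ (proj₂ (level-sums₃ a a≤3))

    sum-b∸1 : β 1F ≡ sumℕ (λ l → b l ∸ 1)
    sum-b∸1 = proj₂ (level-sums₂ b b≤2)

    sum-e∸1 : ε 1F ≡ sumℕ (λ l → e l ∸ 1)
    sum-e∸1 = proj₂ (level-sums₂ e e≤2)

    α-total : α 0F + (α 1F + α 2F) ≡ d₁ + d₂ + d₃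
    α-total = trans sum-a dim-M

    β-total : β 0F + β 1F ≡ d₁ + d₂
    β-total = trans (proj₁ (level-sums₂ b b≤2)) dim-M₂

    ε-total : ε 0F + ε 1F ≡ d₂ + d₃
    ε-total = trans (proj₁ (level-sums₂ e e≤2)) dim-M/M₁

    β₂≤d₂ : β 1F ≤ d₂
    β₂≤d₂ = subst (_≤ d₂) (sym sum-b∸1) rank-T₂≤d₂

    ε₂≤d₃ : ε 1F ≤ d₃
    ε₂≤d₃ = subst (_≤ d₃) (sym sum-e∸1) rank-T̄≤d₃

    α₂₃≤β₂+d₃ : α 1F + α 2F ≤ β 1F + d₃
    α₂₃≤β₂+d₃ = subst₂ _≤_ (sym sum-a∸1) (cong (_+ d₃) (sym sum-b∸1)) rank-T≤rank-T₂+d₃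

    α₃≤β₂ : α 2F ≤ β 1F
    α₃≤β₂ = subst₂ _≤_ (sym sum-a∸2) (sym sum-b∸1) rank-T²≤rank-T₂

    α₂₃≤ε₂+d₁ : α 1F + α 2F ≤ ε 1F + d₁
    α₂₃≤ε₂+d₁ = subst₂ _≤_ (sym sum-a∸1) (cong (_+ d₁) (sym sum-e∸1)) rank-T≤rank-T̄+d₁

    α₃≤ε₂ : α 2F ≤ ε 1F
    α₃≤ε₂ = subst₂ _≤_ (sym sum-a∸2) (sym sum-e∸1) rank-T²≤rank-T̄

    α₃≤d₃ : α 2F ≤ d₃
    α₃≤d₃ = ℕ.≤-trans α₃≤ε₂ ε₂≤d₃

    d₁≤α₁ : d₁ ≤ α 0F
    d₁≤α₁ = ℕ.+-cancelʳ-≤ (d₂ + d₃) d₁ (α 0F) (begin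
      d₁ + (d₂ + d₃)          ≡⟨ trans (sym (ℕ.+-assoc d₁ d₂ d₃)) (sym α-total) ⟩
      α 0F + (α 1F + α 2F)    ≤⟨ ℕ.+-monoʳ-≤ (α 0F) (ℕ.≤-trans α₂₃≤β₂+d₃ (ℕ.+-monoˡ-≤ d₃ β₂≤d₂)) ⟩
      α 0F + (d₂ + d₃)        ∎)

    d₁₂≤α₁₂ : d₁ + d₂ ≤ α 0F + α 1F
    d₁₂≤α₁₂ = ℕ.+-cancelʳ-≤ (α 2F) (d₁ + d₂) (α 0F + α 1F) (begin
      d₁ + d₂ + α 2F          ≤⟨ ℕ.+-monoʳ-≤ (d₁ + d₂) α₃≤d₃ ⟩
      d₁ + d₂ + d₃            ≡⟨ trans (sym α-total) (sym (ℕ.+-assoc (α 0F) (α 1F) (α 2F))) ⟩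
      α 0F + α 1F + α 2F      ∎)

    d≤α₁ : ∀ {d} → d ≤ d₁ → d ≤ α 0F
    d≤α₁ d≤d₁ = ℕ.≤-trans d≤d₁ d₁≤α₁

    d+d₁≤α₁₂ : ∀ {d} → d ≤ d₂ → d + d₁ ≤ α 0F + α 1F
    d+d₁≤α₁₂ {d} d≤d₂ = ℕ.≤-trans (ℕ.≤-trans (ℕ.+-monoˡ-≤ d₁ d≤d₂) (ℕ.≤-reflexive (ℕ.+-comm d₂ d₁))) d₁₂≤α₁₂

    β-submajorized : Submajorized₃ (β 0F) (β 1F) d₃ (α 0F) (α 1F) (α 2F)
    β-submajorized = submajorized₃
      (trans (sym (ℕ.+-assoc (β 0F) (β 1F) d₃)) (trans (cong (_+ d₃) β-total) (sym α-total)))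
      α₂₃≤β₂+d₃ α₃≤β₂ α₃≤d₃ (d≤α₁ (ℕ.≤-trans β₂≤d₂ d₂≤d₁)) (d≤α₁ (ℕ.≤-trans d₃≤d₂ d₂≤d₁))
      (ℕ.≤-trans (ℕ.+-monoʳ-≤ (β 1F) (ℕ.≤-trans d₃≤d₂ d₂≤d₁)) (d+d₁≤α₁₂ β₂≤d₂))

    ε-submajorized : Submajorized₃ (ε 0F) (ε 1F) d₁ (α 0F) (α 1F) (α 2F)
    ε-submajorized = submajorized₃
      (trans (sym (ℕ.+-assoc (ε 0F) (ε 1F) d₁)) (trans (cong (_+ d₁) ε-total)
        (trans (ℕ.+-comm (d₂ + d₃) d₁) (trans (sym (ℕ.+-assoc d₁ d₂ d₃)) (sym α-total)))))
      α₂₃≤ε₂+d₁ α₃≤ε₂ (ℕ.≤-trans α₃≤d₃ (ℕ.≤-trans d₃≤d₂ d₂≤d₁))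
      (d≤α₁ (ℕ.≤-trans ε₂≤d₃ (ℕ.≤-trans d₃≤d₂ d₂≤d₁))) d₁≤α₁ (d+d₁≤α₁₂ (ℕ.≤-trans ε₂≤d₃ d₃≤d₂))

    Hdg-in-Y : InY h d₁ d₂ d₃ (Hdg 3 h a) (Hdg 2 h b) (Hdg 2 h e)
    Hdg-in-Y =
        Hdg₃∈𝒫₃ h a a≤3 , Hdg₂∈𝒫₂ h b b≤2 , Hdg₂∈𝒫₂ h e e≤2
      , trans (Hdg₃-at-h h a a≤3) (cong (λ n → + n / 3) α-total)
      , trans (Hdg₂-at-h h b b≤2) (cong (λ n → + n / 2) β-total)
      , trans (Hdg₂-at-h h e e≤2) (cong (λ n → + n / 2) ε-total)
      , Hdg₃≥star h a b d₃ a≤3 b≤2 β-submajorized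
      , Hdg₃≥star h a e d₁ a≤3 e≤2 ε-submajorized
      , Hdg₂≥P h b d₁ d₂ b≤2 (submajorized₂ d₂≤d₁ β-total β₂≤d₂)
      , Hdg₂≥P h e d₂ d₃ e≤2 (submajorized₂ d₃≤d₂ ε-total ε₂≤d₃)

-- T³ = 0 and generation by h elements enter only through the decompositions (a l ≤ 3, h summands).
mainTheorem6 : ∀ {c ℓ : Level} (F : Field c ℓ) (h : ℕ) → 1 ≤ h →
    (d₁ d₂ d₃ : ℕ) → d₁ ≥ d₂ → d₂ ≥ d₃ → d₁ ≤ h → d₂ ≤ h → d₃ ≤ h →
    (A : LinAlg.Mat F (d₁ Data.Nat.+ d₂ Data.Nat.+ d₃) (d₁ Data.Nat.+ d₂ Data.Nat.+ d₃)) →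
    LinAlg.IsModuleOver F 3 A →
    LinAlg.GeneratedBy≤ F 3 h A →
    PR.IsPRDatum F d₁ d₂ d₃ A →
    (a b e : Fin h → ℕ) →
    (∀ l → a l ≤ 3) → LinAlg.IsCyclicDecomp F h A a →
    (∀ l → b l ≤ 2) → LinAlg.IsCyclicDecomp F h (PR.onM₂ F d₁ d₂ d₃ A) b →
    (∀ l → e l ≤ 2) → LinAlg.IsCyclicDecomp F h (PR.onM/M₁ F d₁ d₂ d₃ A) e →
    InY h d₁ d₂ d₃ (Hdg 3 h a) (Hdg 2 h b) (Hdg 2 h e)
mainTheorem6 F h _ d₁ d₂ d₃ d₂≤d₁ d₃≤d₂ _ _ _ A _ _ pr a b e a≤3 M≅⊕ b≤2 M₂≅⊕ e≤2 M/M₁≅⊕ =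
  LevelInequalities.FromRanks.Hdg-in-Y d₂≤d₁ d₃≤d₂ a≤3 b≤2 e≤2
    (PRDatum.rankInequalities F d₁ d₂ d₃ A pr a b e M≅⊕ M₂≅⊕ M/M₁≅⊕)
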